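{- For every positive integer $k$, with $n=4k$: $$\mathrm{SgnAltrun}_{4k,a,a}(p,q)=\mathrm{SgnAltrun}_{4k,d,d}(p,q)=(1+pq)(1-pq)^{2(k-1)},$$ $$\mathrm{SgnAltrun}_{4k,a,d}(p,q)=-2p(1-pq)^{2(k-1)},\qquad \mathrm{SgnAltrun}_{4k,d,a}(p,q)=-2q(1-pq)^{2(k-1)},$$ $$\mathrm{SgnAltrun}_{4k}(p,q)=2(1-p)(1-q)(1-pq)^{2(k-1)}.$$
   Context: For $\pi=\pi_1\cdots\pi_n\in\mathfrak{S}_n$ let $\mathrm{inv}(\pi)=|\{i<j:\pi_i>\pi_j\}|$, let $\mathrm{pk}(\pi)$ (resp. $\mathrm{val}(\pi)$) be the number of indices $2\le i\le n-1$ with $\pi_{i-1}<\pi_i>\pi_{i+1}$ (resp. $\pi_{i-1}>\pi_i<\pi_{i+1}$). For $n\ge 3$ and $x,y\in\{a,d\}$, let $\mathfrak{S}_{n,x,y}$ be the set of $\pi\in\mathfrak{S}_n$ such that the first pair $(\pi_1,\pi_2)$ is an ascent ($\pi_1<\pi_2$) if $x=a$ and a descent ($\pi_1>\pi_2$) if $x=d$, and the last pair $(\pi_{n-1},\pi_n)$ is an ascent if $y=a$ and a descent if $y=d$. Define $\mathrm{SgnAltrun}_{n,x,y}(p,q)=\sum_{\pi\in\mathfrak{S}_{n,x,y}}(-1)^{\mathrm{inv}(\pi)}p^{\mathrm{pk}(\pi)}q^{\mathrm{val}(\pi)}$ and $\mathrm{SgnAltrun}_n(p,q)=\sum_{\pi\in\mathfrak{S}_n}(-1)^{\mathrm{inv}(\pi)}p^{\mathrm{pk}(\pi)}q^{\mathrm{val}(\pi)}$.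 -}

module Defs where

open import Level using (Level)
open import Data.Nat as ℕ using (ℕ; zero; suc; _<ᵇ_)
open import Data.Bool using (Bool; true; false; if_then_else_; _∧_)
open import Data.Fin using (Fin; toℕ)
open import Data.Fin.Properties using (all?)
open import Data.Vec using (Vec; []; _∷_; toList)
open import Data.List using (List; []; _∷_; map; concatMap; filter; foldr)
open import Relation.Nullary using (Dec; ¬_)
open import Relation.Binary.PropositionalEquality using (_≡_)
open import Function using (Injective)
open import Algebra.Bundles using (CommutativeRing)

allVecs : (m n : ℕ) → List (Vec (Fin n) m)
allVecs zero    n = [] ∷ []
allVecs (suc m) n = concatMap (λ v → map (_∷ v) (Data.List.allFin n)) (allVecs m n)
  where import Data.List

lookupV : {m n : ℕ} → Vec (Fin n) m → Fin m → Fin n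
lookupV v i = Data.Vec.lookup v i
  where import Data.Vec

IsPerm : {n : ℕ} → Vec (Fin n) n → Set
IsPerm {n} v = Injective _≡_ _≡_ (lookupV v)

isPerm? : {n : ℕ} → (v : Vec (Fin n) n) → Dec (IsPerm v)
isPerm? {n} v = inj? where
  open import Data.Fin.Properties using (_≟_)
  open import Relation.Nullary.Decidable using (_→-dec_)
  inj? : Dec (∀ {i j} → lookupV v i ≡ lookupV v j → i ≡ j)
  inj? = Relation.Nullary.Decidable.map′
           (λ f {i} {j} → f i j) (λ f i j → f {i} {j})
           (all? λ i → all? λ j → (lookupV v i ≟ lookupV v j) →-dec (i ≟ j))
    where import Relation.Nullary.Decidable

-- The symmetric group 𝔖ₙ, enumerated as a list of one-line notations (values 0,…,n-1).
perms : (n : ℕ) → List (Vec (Fin n) n)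
perms n = filter isPerm? (allVecs n n)

b2n : Bool → ℕ
b2n true  = 1
b2n false = 0

inv : List ℕ → ℕ
inv []       = 0
inv (x ∷ xs) = foldr (λ y acc → b2n (y <ᵇ x) ℕ.+ acc) 0 xs ℕ.+ inv xs

pk : List ℕ → ℕ
pk (a ∷ b ∷ c ∷ xs) = b2n ((a <ᵇ b) ∧ (c <ᵇ b)) ℕ.+ pk (b ∷ c ∷ xs)
pk _ = 0

val : List ℕ → ℕ
val (a ∷ b ∷ c ∷ xs) = b2n ((b <ᵇ a) ∧ (b <ᵇ c)) ℕ.+ val (b ∷ c ∷ xs)
val _ = 0

word : {n : ℕ} → Vec (Fin n) n → List ℕ
word v = map toℕ (toList v)

-- Type of a pair: ascent (a) or descent (d).
data AD : Set where
  a d : AD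

firstPair : List ℕ → AD
firstPair (x ∷ y ∷ _) = if x <ᵇ y then a else d
firstPair _ = a

lastPair : List ℕ → AD
lastPair (x ∷ y ∷ []) = if x <ᵇ y then a else d
lastPair (_ ∷ xs@(_ ∷ _ ∷ _)) = lastPair xs
lastPair _ = a

adEq : AD → AD → Bool
adEq a a = true
adEq d d = true
adEq _ _ = false

module _ {c ℓ : Level} (R : CommutativeRing c ℓ) where
  open CommutativeRing R

  pow : Carrier → ℕ → Carrier
  pow x zero    = 1#
  pow x (suc m) = x * pow x m

  sumR : List Carrier → Carrier
  sumR = foldr _+_ 0#

  weight : Carrier → Carrier → List ℕ → Carrier
  weight p q w = pow (- 1#) (inv w) * (pow p (pk w) * pow q (val w))

  SgnAltrun : ℕ → Carrier → Carrier → Carrier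
  SgnAltrun n p q = sumR (map (λ v → weight p q (word v)) (perms n))

  SgnAltrunXY : ℕ → AD → AD → Carrier → Carrier → Carrier
  SgnAltrunXY n x y p q =
    sumR (map (λ v → if adEq (firstPair (word v)) x ∧ adEq (lastPair (word v)) y
                     then weight p q (word v) else 0#) (perms n))

-- Let τ exchange the two largest letters of a permutation π of n. Unless they are adjacent at the very start
-- or the very end of π, the permutations π and τπ have the same peaks, valleys and first and last pair types,
-- while their numbers of inversions differ by one, so their weights cancel. In the surviving permutations the
-- two largest letters can be deleted, leaving a permutation of n − 2 whose weight changes by a factor depending
-- only on its first and last pair types. For the sums Σ_π φ(first π, last π) (−1)^inv p^pk q^val with an
-- arbitrary weight φ on the four pair types this is a linear recursion φ ↦ step φ from n to n − 2. For n = 2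
-- the sum is φ(a, a) − φ(d, d), and step ∘ step multiplies this quantity by (1 − pq)², which settles all
-- n ≡ 2 (mod 4); one more step gives n = 4k.

module Submission where

open import Defs
open import Level using (Level)
open import Data.Nat as ℕ using (ℕ; suc)
open import Algebra.Bundles using (CommutativeRing)
open import Data.Product using (_×_; _,_)

module ℤ-CoefficientSolver {c ℓ : Level} (R : CommutativeRing c ℓ) where
  open import Data.Nat as ℕ using (ℕ; zero; suc)
  import Data.Nat.Properties as ℕ
  open import Data.Integer as ℤ using (ℤ; +_; -[1+_])
  import Data.Integer.Properties as ℤ
  open import Data.Sign as Sign using (Sign)
  open import Data.Maybe using (Maybe; just; nothing)
  open import Relation.Nullary using (yes; no)
  import Relation.Binary.PropositionalEquality as ≡
  open import Algebra.Solver.Ring.AlmostCommutativeRing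
    using (fromCommutativeRing; _-Raw-AlmostCommutative⟶_)

  open CommutativeRing R
  open import Algebra.Properties.Ring ring using (-‿involutive; -‿distribˡ-*; -‿distribʳ-*; -0#≈0#)
  open import Algebra.Properties.AbelianGroup +-abelianGroup using (⁻¹-∙-comm)
  open import Algebra.Properties.CommutativeSemigroup +-commutativeSemigroup using (interchange)
  open import Algebra.Properties.Semiring.Mult.TCOptimised semiring using (1+×; ×-homo-+; ×1-homo-*) renaming (_×_ to _×ᴿ_)
  open import Relation.Binary.Reasoning.Setoid setoid

  ι : ℕ → Carrier
  ι n = n ×ᴿ 1#

  ⟦_⟧ℤ : ℤ → Carrier
  ⟦ + n ⟧ℤ      = ι n
  ⟦ -[1+ n ] ⟧ℤ = - ι (suc n)

  ⊖-homo : ∀ m n → ⟦ m ℤ.⊖ n ⟧ℤ ≈ ι m - ι n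
  ⊖-homo m       zero    = sym (trans (+-congˡ -0#≈0#) (+-identityʳ _))
  ⊖-homo zero    (suc n) = sym (+-identityˡ _)
  ⊖-homo (suc m) (suc n) = begin
    ⟦ suc m ℤ.⊖ suc n ⟧ℤ          ≡⟨ ≡.cong ⟦_⟧ℤ (ℤ.[1+m]⊖[1+n]≡m⊖n m n) ⟩
    ⟦ m ℤ.⊖ n ⟧ℤ                  ≈⟨ ⊖-homo m n ⟩
    ι m - ι n                     ≈⟨ +-identityˡ _ ⟨
    0# + (ι m - ι n)              ≈⟨ +-congʳ (-‿inverseʳ 1#) ⟨
    (1# - 1#) + (ι m - ι n)       ≈⟨ interchange 1# (- 1#) (ι m) (- ι n) ⟩
    (1# + ι m) + (- 1# + - ι n)   ≈⟨ +-congˡ (⁻¹-∙-comm 1# (ι n)) ⟩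
    (1# + ι m) - (1# + ι n)       ≈⟨ +-cong (1+× m 1#) (-‿cong (1+× n 1#)) ⟨
    ι (suc m) - ι (suc n)         ∎

  +-homo : ∀ i j → ⟦ i ℤ.+ j ⟧ℤ ≈ ⟦ i ⟧ℤ + ⟦ j ⟧ℤ
  +-homo (+ m)    (+ n)    = ×-homo-+ 1# m n
  +-homo (+ m)    -[1+ n ] = ⊖-homo m (suc n)
  +-homo -[1+ m ] (+ n)    = trans (⊖-homo n (suc m)) (+-comm _ _)
  +-homo -[1+ m ] -[1+ n ] = begin
    - ι (suc (suc (m ℕ.+ n)))  ≡⟨ ≡.cong (λ k → - ι (suc k)) (ℕ.+-suc m n) ⟨
    - ι (suc m ℕ.+ suc n)      ≈⟨ -‿cong (×-homo-+ 1# (suc m) (suc n)) ⟩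
    - (ι (suc m) + ι (suc n))  ≈⟨ ⁻¹-∙-comm _ _ ⟨
    - ι (suc m) + - ι (suc n)  ∎

  signed : Sign → Carrier → Carrier
  signed Sign.+ x = x
  signed Sign.- x = - x

  signed-cong : ∀ s {x y} → x ≈ y → signed s x ≈ signed s y
  signed-cong Sign.+ x≈y = x≈y
  signed-cong Sign.- x≈y = -‿cong x≈y

  ◃-homo : ∀ s n → ⟦ s ℤ.◃ n ⟧ℤ ≈ signed s (ι n)
  ◃-homo Sign.+ zero    = refl
  ◃-homo Sign.- zero    = sym -0#≈0#
  ◃-homo Sign.+ (suc n) = refl
  ◃-homo Sign.- (suc n) = refl

  signed-* : ∀ s t x y → signed (s Sign.* t) (x * y) ≈ signed s x * signed t y
  signed-* Sign.+ Sign.+ x y = refl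
  signed-* Sign.+ Sign.- x y = -‿distribʳ-* x y
  signed-* Sign.- Sign.+ x y = -‿distribˡ-* x y
  signed-* Sign.- Sign.- x y = begin
    x * y          ≈⟨ -‿involutive _ ⟨
    - - (x * y)    ≈⟨ -‿cong (-‿distribʳ-* x y) ⟩
    - (x * - y)    ≈⟨ -‿distribˡ-* x (- y) ⟩
    - x * - y      ∎

  ⟦⟧ℤ-signed : ∀ i → ⟦ i ⟧ℤ ≈ signed (ℤ.sign i) (ι ℤ.∣ i ∣)
  ⟦⟧ℤ-signed (+ n)    = refl
  ⟦⟧ℤ-signed -[1+ n ] = refl

  *-homo : ∀ i j → ⟦ i ℤ.* j ⟧ℤ ≈ ⟦ i ⟧ℤ * ⟦ j ⟧ℤ
  *-homo i j = begin
    ⟦ i ℤ.* j ⟧ℤ                                ≈⟨ ◃-homo (s Sign.* t) (ℤ.∣ i ∣ ℕ.* ℤ.∣ j ∣) ⟩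
    signed (s Sign.* t) (ι (ℤ.∣ i ∣ ℕ.* ℤ.∣ j ∣)) ≈⟨ signed-cong (s Sign.* t) (×1-homo-* ℤ.∣ i ∣ ℤ.∣ j ∣) ⟩
    signed (s Sign.* t) (ι ℤ.∣ i ∣ * ι ℤ.∣ j ∣)   ≈⟨ signed-* s t _ _ ⟩
    signed s (ι ℤ.∣ i ∣) * signed t (ι ℤ.∣ j ∣)   ≈⟨ *-cong (⟦⟧ℤ-signed i) (⟦⟧ℤ-signed j) ⟨
    ⟦ i ⟧ℤ * ⟦ j ⟧ℤ                             ∎
    where s = ℤ.sign i
          t = ℤ.sign j

  -‿homo : ∀ i → ⟦ ℤ.- i ⟧ℤ ≈ - ⟦ i ⟧ℤ
  -‿homo (+ zero)  = sym -0#≈0#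
  -‿homo (+ suc n) = refl
  -‿homo -[1+ n ]  = sym (-‿involutive _)

  ℤ⟶R : ℤ.+-*-rawRing -Raw-AlmostCommutative⟶ fromCommutativeRing R
  ℤ⟶R = record
    { ⟦_⟧ = ⟦_⟧ℤ ; +-homo = +-homo ; *-homo = *-homo ; -‿homo = -‿homo ; 0-homo = refl ; 1-homo = refl }

  ⟦⟧ℤ-equal? : ∀ i j → Maybe (⟦ i ⟧ℤ ≈ ⟦ j ⟧ℤ)
  ⟦⟧ℤ-equal? i j with i ℤ.≟ j
  ... | yes ≡.refl = just refl
  ... | no _       = nothing

  open import Algebra.Solver.Ring ℤ.+-*-rawRing (fromCommutativeRing R) ℤ⟶R ⟦⟧ℤ-equal? public

module Words where
  open import Data.Nat using (ℕ; zero; suc; _+_; _<_; _≤_; _≡ᵇ_; _<ᵇ_; z≤n; s≤s)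
  import Data.Nat.Properties as ℕ
  open import Data.Bool using (Bool; true; false; T; _∧_; _∨_; not; if_then_else_)
  open import Data.Bool.Properties using (∨-conicalˡ; ∨-conicalʳ; ∧-conicalˡ; ∧-conicalʳ; ∨-zeroʳ; ∧-zeroʳ; ∨-assoc; not-injective)
  open import Data.List using (List; []; _∷_; length; _++_; map)
  open import Data.List.Relation.Unary.All using (All; []; _∷_)
  open import Data.Empty using (⊥-elim)
  open import Relation.Binary.PropositionalEquality
  open import Data.Fin using (Fin; toℕ)
  import Data.Fin as Fin
  import Data.Fin.Properties as Fin
  open import Data.Vec using (Vec; []; _∷_; toList)
  open import Data.Product using (Σ; _,_)
  open import Function using (Injective)
  open import Relation.Nullary using (does; contradiction)
  open import Relation.Nullary.Decidable using (dec-true; dec-false)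

  ≡ᵇ-refl : ∀ n → (n ≡ᵇ n) ≡ true
  ≡ᵇ-refl zero    = refl
  ≡ᵇ-refl (suc n) = ≡ᵇ-refl n

  ≡ᵇ-true⇒≡ : ∀ {x y} → (x ≡ᵇ y) ≡ true → x ≡ y
  ≡ᵇ-true⇒≡ {x} {y} e = ℕ.≡ᵇ⇒≡ x y (subst T (sym e) _)

  ≡ᵇ-false : ∀ {x y} → x ≢ y → (x ≡ᵇ y) ≡ false
  ≡ᵇ-false {x} {y} x≢y with x ≡ᵇ y in e
  ... | true  = ⊥-elim (x≢y (≡ᵇ-true⇒≡ e))
  ... | false = refl

  ≡ᵇ-false⇒≢ : ∀ {x y} → (x ≡ᵇ y) ≡ false → x ≢ y
  ≡ᵇ-false⇒≢ {x} e refl with () ← trans (sym (≡ᵇ-refl x)) e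

  <ᵇ-true : ∀ {x y} → x < y → (x <ᵇ y) ≡ true
  <ᵇ-true {x} {y} x<y with x <ᵇ y | ℕ.<⇒<ᵇ x<y
  ... | true | _ = refl

  <ᵇ-false : ∀ {x y} → y ≤ x → (x <ᵇ y) ≡ false
  <ᵇ-false {x} {y} y≤x with x <ᵇ y in e
  ... | true  = ⊥-elim (ℕ.<⇒≱ (ℕ.<ᵇ⇒< x y (subst T (sym e) _)) y≤x)
  ... | false = refl

  <ᵇ-sucʳ : ∀ x n → x ≢ n → (x <ᵇ suc n) ≡ (x <ᵇ n)
  <ᵇ-sucʳ zero    zero    x≢n = ⊥-elim (x≢n refl)
  <ᵇ-sucʳ zero    (suc n) x≢n = refl
  <ᵇ-sucʳ (suc x) zero    x≢n = refl
  <ᵇ-sucʳ (suc x) (suc n) x≢n = <ᵇ-sucʳ x n (λ e → x≢n (cong suc e))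

  <ᵇ-sucˡ : ∀ y n → y ≢ n → y ≢ suc n → (suc n <ᵇ y) ≡ (n <ᵇ y)
  <ᵇ-sucˡ zero          n       _   _    = refl
  <ᵇ-sucˡ (suc zero)    zero    _   y≢1  = ⊥-elim (y≢1 refl)
  <ᵇ-sucˡ (suc (suc y)) zero    _   _    = refl
  <ᵇ-sucˡ (suc y)       (suc n) y≢n y≢sn = <ᵇ-sucˡ y n (λ e → y≢n (cong suc e)) (λ e → y≢sn (cong suc e))

  occurs : ℕ → List ℕ → Bool
  occurs t []       = false
  occurs t (x ∷ xs) = (x ≡ᵇ t) ∨ occurs t xs

  distinct : List ℕ → Bool
  distinct []       = true
  distinct (x ∷ xs) = not (occurs x xs) ∧ distinct xs

  δ : ℕ → ℕ → ℕ
  δ x t = b2n (x ≡ᵇ t)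

  δ-absent : ∀ {x t} → x ≢ t → δ x t ≡ 0
  δ-absent x≢t rewrite ≡ᵇ-false x≢t = refl

  count : ℕ → List ℕ → ℕ
  count t []       = 0
  count t (x ∷ xs) = δ x t + count t xs

  occurs-head : ∀ x xs → occurs x (x ∷ xs) ≡ true
  occurs-head x xs rewrite ≡ᵇ-refl x = refl

  occurs-tail : ∀ {t} x xs → occurs t xs ≡ true → occurs t (x ∷ xs) ≡ true
  occurs-tail {t} x xs o = trans (cong ((x ≡ᵇ t) ∨_) o) (∨-zeroʳ (x ≡ᵇ t))

  distinct-head : ∀ {x xs} → distinct (x ∷ xs) ≡ true → occurs x xs ≡ false
  distinct-head {x} {xs} dist = not-injective (∧-conicalˡ _ _ dist)

  distinct-tail : ∀ {x xs} → distinct (x ∷ xs) ≡ true → distinct xs ≡ true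
  distinct-tail {x} {xs} dist = ∧-conicalʳ _ _ dist

  occurs-≢ : ∀ {t s xs} → occurs t xs ≡ true → occurs s xs ≡ false → t ≢ s
  occurs-≢ o o′ refl with () ← trans (sym o) o′

  occurs-∷-≢ : ∀ {t x} xs → x ≢ t → occurs t (x ∷ xs) ≡ occurs t xs
  occurs-∷-≢ xs x≢t rewrite ≡ᵇ-false x≢t = refl

  occurs-head-≢ : ∀ {t} x xs → occurs t (x ∷ xs) ≡ false → x ≢ t
  occurs-head-≢ {t} x xs o = ≡ᵇ-false⇒≢ (∨-conicalˡ _ _ o)

  occurs-tail-false : ∀ {t} x xs → occurs t (x ∷ xs) ≡ false → occurs t xs ≡ false
  occurs-tail-false {t} x xs o = ∨-conicalʳ (x ≡ᵇ t) _ o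

  occurs-≥ : ∀ {t K xs} → All (_< K) xs → K ≤ t → occurs t xs ≡ false
  occurs-≥                 []            K≤t = refl
  occurs-≥ {t} {xs = x ∷ _} (x<K ∷ xs<K) K≤t
    rewrite ≡ᵇ-false {x} {t} (λ { refl → ℕ.<⇒≱ x<K K≤t }) = occurs-≥ xs<K K≤t

  count-absent : ∀ {t} xs → occurs t xs ≡ false → count t xs ≡ 0
  count-absent         []       o = refl
  count-absent {t} (x ∷ xs) o
    rewrite ∨-conicalˡ (x ≡ᵇ t) _ o = count-absent xs (occurs-tail-false x xs o)

  count-distinct : ∀ {t} xs → distinct xs ≡ true → occurs t xs ≡ true → count t xs ≡ 1
  count-distinct {t} (x ∷ xs) dist o with x ≡ᵇ t in e
  ... | true  = cong suc (count-absent xs (subst (λ z → occurs z xs ≡ false) (≡ᵇ-true⇒≡ e) (distinct-head {x} {xs} dist)))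
  ... | false = count-distinct xs (distinct-tail {x} {xs} dist) o

  occurs-++ : ∀ t r s → occurs t (r ++ s) ≡ (occurs t r ∨ occurs t s)
  occurs-++ t []      s = refl
  occurs-++ t (x ∷ r) s rewrite occurs-++ t r s = sym (∨-assoc (x ≡ᵇ t) (occurs t r) (occurs t s))

  distinct-++-shared : ∀ t r s → occurs t r ≡ true → occurs t s ≡ true → distinct (r ++ s) ≡ false
  distinct-++-shared t (x ∷ r) s otr ots with x ≡ᵇ t in e
  ... | true  = cong (λ u → not u ∧ distinct (r ++ s)) x∈r++s
    where
    x∈r++s : occurs x (r ++ s) ≡ true
    x∈r++s = subst (λ u → occurs u (r ++ s) ≡ true) (sym (≡ᵇ-true⇒≡ e))
                   (trans (occurs-++ t r s) (trans (cong (occurs t r ∨_) ots) (∨-zeroʳ _)))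
  ... | false rewrite distinct-++-shared t r s otr ots = ∧-zeroʳ _

  delete : ℕ → List ℕ → List ℕ
  delete t []       = []
  delete t (x ∷ xs) = if x ≡ᵇ t then xs else x ∷ delete t xs

  length-delete : ∀ t xs → occurs t xs ≡ true → length xs ≡ suc (length (delete t xs))
  length-delete t (x ∷ xs) o with x ≡ᵇ t
  ... | true  = refl
  ... | false = cong suc (length-delete t xs o)

  delete-absent : ∀ s t xs → occurs s xs ≡ false → occurs s (delete t xs) ≡ false
  delete-absent s t []       o = refl
  delete-absent s t (x ∷ xs) o with x ≡ᵇ t
  ... | true  = occurs-tail-false x xs o
  ... | false rewrite ∨-conicalˡ (x ≡ᵇ s) _ o = delete-absent s t xs (occurs-tail-false x xs o)

  distinct-delete : ∀ t xs → distinct xs ≡ true → distinct (delete t xs) ≡ true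
  distinct-delete t []       dist = refl
  distinct-delete t (x ∷ xs) dist with x ≡ᵇ t
  ... | true  = distinct-tail {x} {xs} dist
  ... | false = cong₂ _∧_ (cong not (delete-absent x t xs (distinct-head {x} {xs} dist)))
                          (distinct-delete t xs (distinct-tail {x} {xs} dist))

  delete-removes : ∀ t xs → distinct xs ≡ true → occurs t (delete t xs) ≡ false
  delete-removes t []       dist = refl
  delete-removes t (x ∷ xs) dist with x ≡ᵇ t in e
  ... | true  = subst (λ z → occurs z xs ≡ false) (≡ᵇ-true⇒≡ e) (distinct-head {x} {xs} dist)
  ... | false rewrite e = delete-removes t xs (distinct-tail {x} {xs} dist)

  All-delete : ∀ {P : ℕ → Set} t xs → All P xs → All P (delete t xs)
  All-delete t []       []         = []
  All-delete t (x ∷ xs) (px ∷ pxs) with x ≡ᵇ t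
  ... | true  = pxs
  ... | false = px ∷ All-delete t xs pxs

  All-<-absent : ∀ K xs → All (_< suc K) xs → occurs K xs ≡ false → All (_< K) xs
  All-<-absent K []       []           o = []
  All-<-absent K (x ∷ xs) (x<1+K ∷ xs<) o =
    ℕ.≤∧≢⇒< (ℕ.≤-pred x<1+K) (occurs-head-≢ x xs o) ∷ All-<-absent K xs xs< (occurs-tail-false x xs o)

  distinct-length-≤ : ∀ K xs → distinct xs ≡ true → All (_< K) xs → length xs ≤ K
  distinct-length-≤ zero    []      dist []       = z≤n
  distinct-length-≤ (suc K) xs      dist xs<      with occurs K xs in o
  ... | true  = subst (_≤ suc K) (sym (length-delete K xs o))
                  (s≤s (distinct-length-≤ K (delete K xs) (distinct-delete K xs dist)
                         (All-<-absent K _ (All-delete K xs xs<) (delete-removes K xs dist))))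
  ... | false = ℕ.m≤n⇒m≤1+n (distinct-length-≤ K xs dist (All-<-absent K xs xs< o))

  distinct-full-occurs : ∀ K xs t → distinct xs ≡ true → All (_< K) xs → length xs ≡ K → t < K →
                         occurs t xs ≡ true
  distinct-full-occurs K xs t dist xs< len t<K with occurs t xs in o
  ... | true  = refl
  ... | false = ⊥-elim (ℕ.<-irrefl len (distinct-length-≤ K (t ∷ xs) (cong₂ _∧_ (cong not o) dist) (t<K ∷ xs<)))

  wordOf : ∀ {N L} → Vec (Fin N) L → List ℕ
  wordOf v = map toℕ (toList v)

  occurs-wordOf : ∀ {N L} (v : Vec (Fin N) L) (i : Fin L) → occurs (toℕ (lookupV v i)) (wordOf v) ≡ true
  occurs-wordOf (x ∷ v) Fin.zero    = occurs-head (toℕ x) (wordOf v)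
  occurs-wordOf (x ∷ v) (Fin.suc i) = occurs-tail (toℕ x) (wordOf v) (occurs-wordOf v i)

  wordOf-occurs : ∀ {N L} (v : Vec (Fin N) L) (x : Fin N) → occurs (toℕ x) (wordOf v) ≡ true →
                  Σ (Fin L) (λ i → lookupV v i ≡ x)
  wordOf-occurs (y ∷ v) x o with toℕ y ≡ᵇ toℕ x in e
  ... | true  = Fin.zero , Fin.toℕ-injective (≡ᵇ-true⇒≡ e)
  ... | false = let i , vᵢ≡x = wordOf-occurs v x o in Fin.suc i , vᵢ≡x

  injective⇒distinct : ∀ {N L} (v : Vec (Fin N) L) → Injective _≡_ _≡_ (lookupV v) → distinct (wordOf v) ≡ true
  injective⇒distinct []      inj = refl
  injective⇒distinct (x ∷ v) inj with occurs (toℕ x) (wordOf v) in o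
  ... | true  with i , vᵢ≡x ← wordOf-occurs v x o with () ← inj {Fin.suc i} {Fin.zero} vᵢ≡x
  ... | false = injective⇒distinct v (λ e → Fin.suc-injective (inj e))

  distinct⇒injective : ∀ {N L} (v : Vec (Fin N) L) → distinct (wordOf v) ≡ true → Injective _≡_ _≡_ (lookupV v)
  distinct⇒injective (x ∷ v) dist {Fin.zero}  {Fin.zero}  e = refl
  distinct⇒injective (x ∷ v) dist {Fin.zero}  {Fin.suc j} e with () ←
    trans (sym (subst (λ z → occurs (toℕ z) (wordOf v) ≡ true) (sym e) (occurs-wordOf v j))) (distinct-head {toℕ x} {wordOf v} dist)
  distinct⇒injective (x ∷ v) dist {Fin.suc i} {Fin.zero}  e with () ←
    trans (sym (subst (λ z → occurs (toℕ z) (wordOf v) ≡ true) e (occurs-wordOf v i))) (distinct-head {toℕ x} {wordOf v} dist)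
  distinct⇒injective (x ∷ v) dist {Fin.suc i} {Fin.suc j} e =
    cong Fin.suc (distinct⇒injective v (distinct-tail {toℕ x} {wordOf v} dist) e)

  isPerm?-distinct : ∀ {n} (v : Vec (Fin n) n) → does (isPerm? v) ≡ distinct (word v)
  isPerm?-distinct v with distinct (word v) in dist
  ... | true  = dec-true (isPerm? v) (distinct⇒injective v dist)
  ... | false = dec-false (isPerm? v) (λ inj → contradiction (trans (sym (injective⇒distinct v inj)) dist) λ ())

module Statistics where
  open import Data.Nat using (ℕ; suc; _+_; _<_; _<ᵇ_)
  import Data.Nat.Properties as ℕ
  open import Data.Bool using (Bool; true; false; _∧_; if_then_else_)
  open import Relation.Binary.Definitions using (tri<; tri≈; tri>)
  open import Data.List using (List; []; _∷_; length; _++_; foldr)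
  open import Data.List.Relation.Unary.All using (All; []; _∷_)
  open import Data.Product using (_×_; _,_; proj₁; proj₂)
  open import Data.Sum using (_⊎_; inj₁; inj₂)
  open import Data.Empty using (⊥-elim)
  open import Relation.Binary.PropositionalEquality
  open Words

  below : ℕ → List ℕ → ℕ
  below x []       = 0
  below x (y ∷ ys) = b2n (y <ᵇ x) + below x ys

  inv-∷ : ∀ x xs → inv (x ∷ xs) ≡ below x xs + inv xs
  inv-∷ x xs = cong (_+ inv xs) (foldr-below xs)
    where
    foldr-below : ∀ ys → foldr (λ y acc → b2n (y <ᵇ x) + acc) 0 ys ≡ below x ys
    foldr-below []       = refl
    foldr-below (y ∷ ys) = cong (b2n (y <ᵇ x) +_) (foldr-below ys)

  below-low : ∀ x r → All (_< x) r → below x r ≡ length r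
  below-low x []       []           = refl
  below-low x (y ∷ r) (y<x ∷ r<x) rewrite <ᵇ-true y<x = cong suc (below-low x r r<x)

  below-++ : ∀ x r s → below x (r ++ s) ≡ below x r + below x s
  below-++ x []      s = refl
  below-++ x (y ∷ r) s rewrite below-++ x r s = sym (ℕ.+-assoc (b2n (y <ᵇ x)) (below x r) (below x s))

  -- pk, val, firstPair and lastPair only see the comparisons of adjacent letters.
  Shape : Set
  Shape = Bool × Bool

  shape : ℕ → ℕ → Shape
  shape x y = (x <ᵇ y) , (y <ᵇ x)

  up down : Shape
  up   = true , false
  down = false , true

  shapes : List ℕ → List Shape
  shapes (x ∷ y ∷ r) = shape x y ∷ shapes (y ∷ r)
  shapes _           = []

  shape-< : ∀ {x y} → x < y → shape x y ≡ up
  shape-< x<y = cong₂ _,_ (<ᵇ-true x<y) (<ᵇ-false (ℕ.<⇒≤ x<y))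

  shape-> : ∀ {x y} → y < x → shape x y ≡ down
  shape-> y<x = cong₂ _,_ (<ᵇ-false (ℕ.<⇒≤ y<x)) (<ᵇ-true y<x)

  peaksOf valleysOf : List Shape → ℕ
  peaksOf (f ∷ g ∷ r) = b2n (proj₁ f ∧ proj₂ g) + peaksOf (g ∷ r)
  peaksOf _           = 0
  valleysOf (f ∷ g ∷ r) = b2n (proj₂ f ∧ proj₁ g) + valleysOf (g ∷ r)
  valleysOf _           = 0

  firstOf lastOf : List Shape → AD
  firstOf (f ∷ _)     = if proj₁ f then a else d
  firstOf []          = a
  lastOf (f ∷ [])     = if proj₁ f then a else d
  lastOf (f ∷ g ∷ r)  = lastOf (g ∷ r)
  lastOf []           = a

  pk-shapes : ∀ w → pk w ≡ peaksOf (shapes w)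
  pk-shapes (x ∷ y ∷ z ∷ r) = cong (b2n ((x <ᵇ y) ∧ (z <ᵇ y)) +_) (pk-shapes (y ∷ z ∷ r))
  pk-shapes (x ∷ y ∷ [])    = refl
  pk-shapes (x ∷ [])        = refl
  pk-shapes []              = refl

  val-shapes : ∀ w → val w ≡ valleysOf (shapes w)
  val-shapes (x ∷ y ∷ z ∷ r) = cong (b2n ((y <ᵇ x) ∧ (y <ᵇ z)) +_) (val-shapes (y ∷ z ∷ r))
  val-shapes (x ∷ y ∷ [])    = refl
  val-shapes (x ∷ [])        = refl
  val-shapes []              = refl

  firstPair-shapes : ∀ w → firstPair w ≡ firstOf (shapes w)
  firstPair-shapes (x ∷ y ∷ r) = refl
  firstPair-shapes (x ∷ [])    = refl
  firstPair-shapes []          = refl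

  lastPair-shapes : ∀ w → lastPair w ≡ lastOf (shapes w)
  lastPair-shapes (x ∷ y ∷ z ∷ r) = lastPair-shapes (y ∷ z ∷ r)
  lastPair-shapes (x ∷ y ∷ [])    = refl
  lastPair-shapes (x ∷ [])        = refl
  lastPair-shapes []              = refl

  -- Swapping the two largest letters when they are adjacent inside a word turns one of these runs into the other.
  HumpInvariant : {B : Set} → (List Shape → B) → Set
  HumpInvariant Φ = ∀ P S → Φ (P ++ up ∷ up ∷ down ∷ S) ≡ Φ (P ++ up ∷ down ∷ down ∷ S)

  peaksOf-hump : HumpInvariant peaksOf
  peaksOf-hump []          S = refl
  peaksOf-hump (f ∷ [])    S = cong (b2n (proj₁ f ∧ false) +_) (peaksOf-hump [] S)
  peaksOf-hump (f ∷ g ∷ P) S = cong (b2n (proj₁ f ∧ proj₂ g) +_) (peaksOf-hump (g ∷ P) S)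

  valleysOf-hump : HumpInvariant valleysOf
  valleysOf-hump []          S = refl
  valleysOf-hump (f ∷ [])    S = cong (b2n (proj₂ f ∧ true) +_) (valleysOf-hump [] S)
  valleysOf-hump (f ∷ g ∷ P) S = cong (b2n (proj₂ f ∧ proj₁ g) +_) (valleysOf-hump (g ∷ P) S)

  firstOf-hump : HumpInvariant firstOf
  firstOf-hump []      S = refl
  firstOf-hump (f ∷ P) S = refl

  lastOf-hump : HumpInvariant lastOf
  lastOf-hump []          S = refl
  lastOf-hump (f ∷ [])    S = refl
  lastOf-hump (f ∷ g ∷ P) S = lastOf-hump (g ∷ P) S

  Flipped : Shape → Shape → Set
  Flipped z z′ = (z ≡ up × z′ ≡ down) ⊎ (z ≡ down × z′ ≡ up)

  hump-flip : ∀ {B : Set} (Φ : List Shape → B) → HumpInvariant Φ →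
              ∀ P {z z′} S → Flipped z z′ → Φ (P ++ up ∷ z′ ∷ down ∷ S) ≡ Φ (P ++ up ∷ z ∷ down ∷ S)
  hump-flip Φ inv P S (inj₁ (refl , refl)) = sym (inv P S)
  hump-flip Φ inv P S (inj₂ (refl , refl)) = inv P S


  SameStatistics : List ℕ → List ℕ → Set
  SameStatistics v w = pk v ≡ pk w × val v ≡ val w × firstPair v ≡ firstPair w × lastPair v ≡ lastPair w

  same-statistics : ∀ v w → (∀ {B : Set} (Φ : List Shape → B) → HumpInvariant Φ → Φ (shapes v) ≡ Φ (shapes w)) →
                    SameStatistics v w
  same-statistics v w agree =
    via peaksOf pk-shapes peaksOf-hump , via valleysOf val-shapes valleysOf-hump ,
    via firstOf firstPair-shapes firstOf-hump , via lastOf lastPair-shapes lastOf-hump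
    where
    via : ∀ {B : Set} {f : List ℕ → B} (Φ : List Shape → B) → (∀ u → f u ≡ Φ (shapes u)) → HumpInvariant Φ → f v ≡ f w
    via Φ f-shapes inv = trans (f-shapes v) (trans (agree Φ inv) (sym (f-shapes w)))

  endsInDescent : List ℕ → Bool
  endsInDescent (u ∷ v ∷ [])         = v <ᵇ u
  endsInDescent (_ ∷ xs@(_ ∷ _ ∷ _)) = endsInDescent xs
  endsInDescent _                    = false

  lastPair-++ : ∀ r X Y → lastPair (r ++ X ∷ Y ∷ []) ≡ lastPair (X ∷ Y ∷ [])
  lastPair-++ []              X Y = refl
  lastPair-++ (x ∷ [])        X Y = refl
  lastPair-++ (x ∷ y ∷ [])    X Y = refl
  lastPair-++ (x ∷ y ∷ z ∷ r) X Y = lastPair-++ (y ∷ z ∷ r) X Y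

  lastPair-endsInDescent : ∀ r₁ r₂ r → distinct (r₁ ∷ r₂ ∷ r) ≡ true →
                           lastPair (r₁ ∷ r₂ ∷ r) ≡ (if endsInDescent (r₁ ∷ r₂ ∷ r) then d else a)
  lastPair-endsInDescent r₁ r₂ (r₃ ∷ r) dist = lastPair-endsInDescent r₂ r₃ r (distinct-tail {r₁} {r₂ ∷ r₃ ∷ r} dist)
  lastPair-endsInDescent r₁ r₂ []       dist with ℕ.<-cmp r₁ r₂
  ... | tri< r₁<r₂ _ _ rewrite <ᵇ-true r₁<r₂ | <ᵇ-false {r₂} {r₁} (ℕ.<⇒≤ r₁<r₂) = refl
  ... | tri≈ _ r₁≡r₂ _ = ⊥-elim (occurs-head-≢ r₂ [] (distinct-head {r₁} {r₂ ∷ []} dist) (sym r₁≡r₂))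
  ... | tri> _ _ r₂<r₁ rewrite <ᵇ-true r₂<r₁ | <ᵇ-false {r₁} {r₂} (ℕ.<⇒≤ r₂<r₁) = refl

-- In a permutation of m + 2, written with the letters 0, …, m + 1, the letters m and m + 1 are the two largest.
module TopSwap (m : ℕ) where
  open import Data.Nat using (ℕ; zero; suc; _+_; _*_; _<_; _≤_; _≡ᵇ_; _<ᵇ_)
  import Data.Nat.Properties as ℕ
  open import Data.Nat.Tactic.RingSolver using (solve-∀)
  open import Data.Bool using (Bool; true; false; _∧_; _∨_; not; if_then_else_)
  open import Data.Bool.Properties using (∧-comm; ∨-comm; ∧-conicalˡ; ∧-conicalʳ; ∧-identityʳ; ∧-zeroʳ; ∨-identityʳ)
  open import Data.List using (List; []; _∷_; map; length; _++_)
  open import Data.List.Relation.Unary.All using (All; []; _∷_)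
  import Data.List.Relation.Unary.All as All
  open import Data.Product using (_×_; _,_; proj₁; proj₂)
  open import Data.Sum using (_⊎_; inj₁; inj₂)
  open import Data.Empty using (⊥; ⊥-elim)
  open import Relation.Nullary using (yes; no)
  open import Relation.Binary.PropositionalEquality
  open Words
  open Statistics

  swap : ℕ → ℕ
  swap x = if x ≡ᵇ m then suc m else (if x ≡ᵇ suc m then m else x)

  1+m≢m : suc m ≢ m
  1+m≢m = ℕ.1+n≢n

  m≢1+m : m ≢ suc m
  m≢1+m e = 1+m≢m (sym e)

  swap-m : swap m ≡ suc m
  swap-m rewrite ≡ᵇ-refl m = refl

  swap-1+m : swap (suc m) ≡ m
  swap-1+m rewrite ≡ᵇ-false 1+m≢m | ≡ᵇ-refl m = refl

  swap-other : ∀ x → x ≢ m → x ≢ suc m → swap x ≡ x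
  swap-other x x≢m x≢1+m rewrite ≡ᵇ-false x≢m | ≡ᵇ-false x≢1+m = refl

  data Letter (x : ℕ) : Set where
    is-m   : x ≡ m → Letter x
    is-1+m : x ≡ suc m → Letter x
    other  : x ≢ m → x ≢ suc m → Letter x

  letter : ∀ x → Letter x
  letter x with x ℕ.≟ m | x ℕ.≟ suc m
  ... | yes x≡m | _         = is-m x≡m
  ... | no  _   | yes x≡1+m = is-1+m x≡1+m
  ... | no  x≢m | no  x≢1+m = other x≢m x≢1+m

  isTopPair : ℕ → ℕ → Bool
  isTopPair x y = ((x ≡ᵇ m) ∧ (y ≡ᵇ suc m)) ∨ ((x ≡ᵇ suc m) ∧ (y ≡ᵇ m))

  isTopPair-m : isTopPair m (suc m) ≡ true
  isTopPair-m rewrite ≡ᵇ-refl m = refl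

  isTopPair-1+m : isTopPair (suc m) m ≡ true
  isTopPair-1+m rewrite ≡ᵇ-refl m | ≡ᵇ-false 1+m≢m = refl

  isTopPair-sym : ∀ x y → isTopPair x y ≡ isTopPair y x
  isTopPair-sym x y =
    trans (∨-comm ((x ≡ᵇ m) ∧ (y ≡ᵇ suc m)) _)
          (cong₂ _∨_ (∧-comm (x ≡ᵇ suc m) (y ≡ᵇ m)) (∧-comm (x ≡ᵇ m) (y ≡ᵇ suc m)))

  swap-<ᵇ : ∀ x y → isTopPair x y ≡ false → (swap x <ᵇ swap y) ≡ (x <ᵇ y)
  swap-<ᵇ x y nt with letter x | letter y
  ... | is-m refl       | is-m refl        rewrite swap-m = refl
  ... | is-m refl       | is-1+m refl      with () ← trans (sym isTopPair-m) nt
  ... | is-m refl       | other y≢m y≢1+m  rewrite swap-m | swap-other y y≢m y≢1+m = <ᵇ-sucˡ y m y≢m y≢1+m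
  ... | is-1+m refl     | is-m refl        with () ← trans (sym isTopPair-1+m) nt
  ... | is-1+m refl     | is-1+m refl      rewrite swap-1+m = refl
  ... | is-1+m refl     | other y≢m y≢1+m  rewrite swap-1+m | swap-other y y≢m y≢1+m = sym (<ᵇ-sucˡ y m y≢m y≢1+m)
  ... | other x≢m x≢1+m | is-m refl        rewrite swap-m | swap-other x x≢m x≢1+m = <ᵇ-sucʳ x m x≢m
  ... | other x≢m x≢1+m | is-1+m refl      rewrite swap-1+m | swap-other x x≢m x≢1+m = sym (<ᵇ-sucʳ x m x≢m)
  ... | other x≢m x≢1+m | other y≢m y≢1+m  rewrite swap-other x x≢m x≢1+m | swap-other y y≢m y≢1+m = refl

  swap-involutive : ∀ x → swap (swap x) ≡ x
  swap-involutive x with letter x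
  ... | is-m refl       rewrite swap-m   = swap-1+m
  ... | is-1+m refl     rewrite swap-1+m = swap-m
  ... | other x≢m x≢1+m rewrite swap-other x x≢m x≢1+m = swap-other x x≢m x≢1+m

  swap-injective : ∀ {x y} → swap x ≡ swap y → x ≡ y
  swap-injective {x} {y} e = trans (sym (swap-involutive x)) (trans (cong swap e) (swap-involutive y))

  swap-≡ᵇ : ∀ x y → (swap x ≡ᵇ swap y) ≡ (x ≡ᵇ y)
  swap-≡ᵇ x y with x ℕ.≟ y
  ... | yes refl = trans (≡ᵇ-refl (swap x)) (sym (≡ᵇ-refl x))
  ... | no  x≢y  = trans (≡ᵇ-false (λ e → x≢y (swap-injective e))) (sym (≡ᵇ-false x≢y))

  occurs-swap : ∀ t xs → occurs (swap t) (map swap xs) ≡ occurs t xs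
  occurs-swap t []       = refl
  occurs-swap t (x ∷ xs) = cong₂ _∨_ (swap-≡ᵇ x t) (occurs-swap t xs)

  distinct-swap : ∀ xs → distinct (map swap xs) ≡ distinct xs
  distinct-swap []       = refl
  distinct-swap (x ∷ xs) = cong₂ (λ u v → not u ∧ v) (occurs-swap x xs) (distinct-swap xs)

  swap-< : ∀ x → x < m → swap x ≡ x
  swap-< x x<m = swap-other x (ℕ.<⇒≢ x<m) (ℕ.<⇒≢ (ℕ.m<n⇒m<1+n x<m))

  map-swap-< : ∀ xs → All (_< m) xs → map swap xs ≡ xs
  map-swap-< []       []           = refl
  map-swap-< (x ∷ xs) (x<m ∷ xs<m) = cong₂ _∷_ (swap-< x x<m) (map-swap-< xs xs<m)

  other-< : ∀ x → x < suc (suc m) → x ≢ m → x ≢ suc m → x < m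
  other-< x x<2+m x≢m x≢1+m = ℕ.≤∧≢⇒< (ℕ.≤-pred (ℕ.≤∧≢⇒< (ℕ.≤-pred x<2+m) x≢1+m)) x≢m

  -- For a single pair (x before y): swapping trades an inversion exactly when {x, y} = {m, 1+m}.
  inversion-swap : ∀ x y → b2n (swap y <ᵇ swap x) + δ x (suc m) * δ y m ≡ b2n (y <ᵇ x) + δ x m * δ y (suc m)
  inversion-swap x y with letter x | letter y
  ... | is-m refl       | is-m refl        rewrite swap-m = top m
    where top : ∀ n → b2n (suc n <ᵇ suc n) + δ n (suc n) * δ n n ≡ b2n (n <ᵇ n) + δ n n * δ n (suc n)
          top zero    = refl
          top (suc n) = top n
  ... | is-m refl       | is-1+m refl      rewrite swap-m | swap-1+m = top m
    where top : ∀ n → b2n (n <ᵇ suc n) + δ n (suc n) * δ (suc n) n ≡ b2n (suc n <ᵇ n) + δ n n * δ (suc n) (suc n)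
          top zero    = refl
          top (suc n) = top n
  ... | is-1+m refl     | is-m refl        rewrite swap-m | swap-1+m = top m
    where top : ∀ n → b2n (suc n <ᵇ n) + δ (suc n) (suc n) * δ n n ≡ b2n (n <ᵇ suc n) + δ (suc n) n * δ n (suc n)
          top zero    = refl
          top (suc n) = top n
  ... | is-1+m refl     | is-1+m refl      rewrite swap-1+m = top m
    where top : ∀ n → b2n (n <ᵇ n) + δ (suc n) (suc n) * δ (suc n) n ≡ b2n (suc n <ᵇ suc n) + δ (suc n) n * δ (suc n) (suc n)
          top zero    = refl
          top (suc n) = top n
  ... | is-m refl       | other y≢m y≢1+m
    rewrite swap-m | swap-other y y≢m y≢1+m | δ-absent y≢m | δ-absent y≢1+m | ℕ.*-zeroʳ (δ m (suc m)) | ℕ.*-zeroʳ (δ m m)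
    = cong (λ b → b2n b + 0) (<ᵇ-sucʳ y m y≢m)
  ... | is-1+m refl     | other y≢m y≢1+m
    rewrite swap-1+m | swap-other y y≢m y≢1+m | δ-absent y≢m | δ-absent y≢1+m | ℕ.*-zeroʳ (δ (suc m) (suc m)) | ℕ.*-zeroʳ (δ (suc m) m)
    = cong (λ b → b2n b + 0) (sym (<ᵇ-sucʳ y m y≢m))
  ... | other x≢m x≢1+m | is-m refl
    rewrite swap-m | swap-other x x≢m x≢1+m | δ-absent x≢m | δ-absent x≢1+m
    = cong (λ b → b2n b + 0) (<ᵇ-sucˡ x m x≢m x≢1+m)
  ... | other x≢m x≢1+m | is-1+m refl
    rewrite swap-1+m | swap-other x x≢m x≢1+m | δ-absent x≢m | δ-absent x≢1+m
    = cong (λ b → b2n b + 0) (sym (<ᵇ-sucˡ x m x≢m x≢1+m))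
  ... | other x≢m x≢1+m | other y≢m y≢1+m
    rewrite swap-other x x≢m x≢1+m | swap-other y y≢m y≢1+m | δ-absent x≢m | δ-absent x≢1+m
    = refl

  below-swap : ∀ x xs → below (swap x) (map swap xs) + δ x (suc m) * count m xs ≡ below x xs + δ x m * count (suc m) xs
  below-swap x []       = trans (ℕ.*-zeroʳ (δ x (suc m))) (sym (ℕ.*-zeroʳ (δ x m)))
  below-swap x (y ∷ ys) = begin
    (b2n (swap y <ᵇ swap x) + below (swap x) (map swap ys)) + δ x (suc m) * (δ y m + count m ys)
      ≡⟨ regroup (b2n (swap y <ᵇ swap x)) _ (δ x (suc m)) _ _ ⟩
    (b2n (swap y <ᵇ swap x) + δ x (suc m) * δ y m) + (below (swap x) (map swap ys) + δ x (suc m) * count m ys)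
      ≡⟨ cong₂ _+_ (inversion-swap x y) (below-swap x ys) ⟩
    (b2n (y <ᵇ x) + δ x m * δ y (suc m)) + (below x ys + δ x m * count (suc m) ys)
      ≡⟨ regroup (b2n (y <ᵇ x)) _ (δ x m) _ _ ⟨
    (b2n (y <ᵇ x) + below x ys) + δ x m * (δ y (suc m) + count (suc m) ys) ∎
    where
    open ≡-Reasoning
    regroup : ∀ A B E C D → (A + B) + E * (C + D) ≡ (A + E * C) + (B + E * D)
    regroup = solve-∀

  inOrder inverted : List ℕ → ℕ
  inOrder []       = 0
  inOrder (x ∷ xs) = δ x m * count (suc m) xs + inOrder xs
  inverted []       = 0
  inverted (x ∷ xs) = δ x (suc m) * count m xs + inverted xs

  inv-swap : ∀ xs → inv (map swap xs) + inverted xs ≡ inv xs + inOrder xs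
  inv-swap []       = refl
  inv-swap (x ∷ xs) = begin
    inv (swap x ∷ map swap xs) + (δ x (suc m) * count m xs + inverted xs)
      ≡⟨ cong (_+ (δ x (suc m) * count m xs + inverted xs)) (inv-∷ (swap x) (map swap xs)) ⟩
    (below (swap x) (map swap xs) + inv (map swap xs)) + (δ x (suc m) * count m xs + inverted xs)
      ≡⟨ interchange (below (swap x) (map swap xs)) _ _ _ ⟩
    (below (swap x) (map swap xs) + δ x (suc m) * count m xs) + (inv (map swap xs) + inverted xs)
      ≡⟨ cong₂ _+_ (below-swap x xs) (inv-swap xs) ⟩
    (below x xs + δ x m * count (suc m) xs) + (inv xs + inOrder xs)
      ≡⟨ interchange (below x xs) _ _ _ ⟩
    (below x xs + inv xs) + (δ x m * count (suc m) xs + inOrder xs)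
      ≡⟨ cong (_+ (δ x m * count (suc m) xs + inOrder xs)) (inv-∷ x xs) ⟨
    inv (x ∷ xs) + (δ x m * count (suc m) xs + inOrder xs) ∎
    where
    open ≡-Reasoning
    interchange : ∀ A B C D → (A + B) + (C + D) ≡ (A + C) + (B + D)
    interchange = solve-∀

  δ-m-1+m : ∀ x → δ x m * δ x (suc m) ≡ 0
  δ-m-1+m x with letter x
  ... | is-m refl       rewrite δ-absent m≢1+m = ℕ.*-zeroʳ (δ m m)
  ... | is-1+m refl     rewrite δ-absent 1+m≢m = refl
  ... | other x≢m x≢1+m rewrite δ-absent x≢m   = refl

  inOrder+inverted : ∀ xs → inOrder xs + inverted xs ≡ count m xs * count (suc m) xs
  inOrder+inverted []       = refl
  inOrder+inverted (x ∷ xs) = begin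
    (δ x m * M′ + inOrder xs) + (δ x (suc m) * M + inverted xs)
      ≡⟨ regroup (δ x m) (δ x (suc m)) M M′ (inOrder xs) (inverted xs) ⟩
    (δ x m * M′ + δ x (suc m) * M) + (inOrder xs + inverted xs)
      ≡⟨ cong ((δ x m * M′ + δ x (suc m) * M) +_) (inOrder+inverted xs) ⟩
    (δ x m * M′ + δ x (suc m) * M) + M * M′
      ≡⟨ cong (_+ ((δ x m * M′ + δ x (suc m) * M) + M * M′)) (δ-m-1+m x) ⟨
    δ x m * δ x (suc m) + ((δ x m * M′ + δ x (suc m) * M) + M * M′)
      ≡⟨ expand (δ x m) (δ x (suc m)) M M′ ⟨
    (δ x m + M) * (δ x (suc m) + M′) ∎
    where
    open ≡-Reasoning
    M = count m xs
    M′ = count (suc m) xs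
    regroup : ∀ A B C D P Q → (A * D + P) + (B * C + Q) ≡ (A * D + B * C) + (P + Q)
    regroup = solve-∀
    expand : ∀ A B C D → (A + C) * (B + D) ≡ A * B + ((A * D + B * C) + C * D)
    expand = solve-∀

  inv-swap-±1 : ∀ xs → distinct xs ≡ true → occurs m xs ≡ true → occurs (suc m) xs ≡ true →
                (inv (map swap xs) ≡ suc (inv xs)) ⊎ (inv xs ≡ suc (inv (map swap xs)))
  inv-swap-±1 xs dist om o1+m with inOrder xs | inverted xs | inv-swap xs | sum≡1
    where
    sum≡1 : inOrder xs + inverted xs ≡ 1
    sum≡1 = trans (inOrder+inverted xs) (cong₂ _*_ (count-distinct xs dist om) (count-distinct xs dist o1+m))
  ... | 0 | 1 | e | _ = inj₂ (trans (sym (ℕ.+-identityʳ _)) (trans (sym e) (ℕ.+-comm _ 1)))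
  ... | 1 | 0 | e | _ = inj₁ (trans (sym (ℕ.+-identityʳ _)) (trans e (ℕ.+-comm _ 1)))

  shape-swap : ∀ x y → isTopPair x y ≡ false → shape (swap x) (swap y) ≡ shape x y
  shape-swap x y nt = cong₂ _,_ (swap-<ᵇ x y nt) (swap-<ᵇ y x (trans (isTopPair-sym y x) nt))

  topPairAtStart topPairAtEnd : List ℕ → Bool
  topPairAtStart (x ∷ y ∷ _) = isTopPair x y
  topPairAtStart _           = false
  topPairAtEnd (x ∷ y ∷ [])         = isTopPair x y
  topPairAtEnd (_ ∷ xs@(_ ∷ _ ∷ _)) = topPairAtEnd xs
  topPairAtEnd _                    = false

  data SwapEffect (w : List ℕ) : Set where
    same    : shapes (map swap w) ≡ shapes w → SwapEffect w
    atStart : ∀ {z z′} S → Flipped z z′ → shapes w ≡ z ∷ down ∷ S → shapes (map swap w) ≡ z′ ∷ down ∷ S →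
              topPairAtStart w ≡ true → occurs m w ≡ true → occurs (suc m) w ≡ true → SwapEffect w
    inside  : ∀ P {z z′} S → Flipped z z′ →
              shapes w ≡ P ++ up ∷ z ∷ down ∷ S → shapes (map swap w) ≡ P ++ up ∷ z′ ∷ down ∷ S →
              occurs m w ≡ true → occurs (suc m) w ≡ true → SwapEffect w

  isTopPair-cases : ∀ x y → isTopPair x y ≡ true → (x ≡ m × y ≡ suc m) ⊎ (x ≡ suc m × y ≡ m)
  isTopPair-cases x y tp with x ≡ᵇ m in e₁ | y ≡ᵇ suc m in e₂ | x ≡ᵇ suc m in e₃ | y ≡ᵇ m in e₄
  ... | true | true | _    | _    = inj₁ (≡ᵇ-true⇒≡ e₁ , ≡ᵇ-true⇒≡ e₂)
  ... | _    | _    | true | true = inj₂ (≡ᵇ-true⇒≡ e₃ , ≡ᵇ-true⇒≡ e₄)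

  m<1+m : m < suc m
  m<1+m = ℕ.≤-refl

  topPair-flipped : ∀ x y → isTopPair x y ≡ true → Flipped (shape x y) (shape (swap x) (swap y))
  topPair-flipped x y tp with isTopPair-cases x y tp
  ... | inj₁ (refl , refl) rewrite swap-m | swap-1+m = inj₁ (shape-< m<1+m , shape-> m<1+m)
  ... | inj₂ (refl , refl) rewrite swap-m | swap-1+m = inj₂ (shape-> m<1+m , shape-< m<1+m)

  topPair-≥ˡ : ∀ x y → isTopPair x y ≡ true → m ≤ x
  topPair-≥ˡ x y tp with isTopPair-cases x y tp
  ... | inj₁ (refl , _) = ℕ.≤-refl
  ... | inj₂ (refl , _) = ℕ.n≤1+n m

  topPair-≥ʳ : ∀ x y → isTopPair x y ≡ true → m ≤ y
  topPair-≥ʳ x y tp = topPair-≥ˡ y x (trans (isTopPair-sym y x) tp)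

  topPair-occurs : ∀ x y r → isTopPair x y ≡ true → occurs m (x ∷ y ∷ r) ≡ true × occurs (suc m) (x ∷ y ∷ r) ≡ true
  topPair-occurs x y r tp with isTopPair-cases x y tp
  ... | inj₁ (refl , refl) = occurs-head m (suc m ∷ r) , occurs-tail m (suc m ∷ r) (occurs-head (suc m) r)
  ... | inj₂ (refl , refl) = occurs-tail (suc m) (m ∷ r) (occurs-head m r) , occurs-head (suc m) (m ∷ r)

  head-not-top : ∀ x r → distinct (x ∷ r) ≡ true → occurs m r ≡ true → occurs (suc m) r ≡ true →
                 x ≢ m × x ≢ suc m
  head-not-top x r dist om o1+m = (λ e → occurs-≢ {xs = r} om (distinct-head {x} {r} dist) (sym e))
                                , (λ e → occurs-≢ {xs = r} o1+m (distinct-head {x} {r} dist) (sym e))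

  top-head-repeated : ∀ x y r → isTopPair x y ≡ true → distinct (x ∷ r) ≡ true →
                      occurs m r ≡ true → occurs (suc m) r ≡ true → ⊥
  top-head-repeated x y r tp dist om o1+m with isTopPair-cases x y tp | head-not-top x r dist om o1+m
  ... | inj₁ (x≡m , _)   | x≢m , _    = x≢m x≡m
  ... | inj₂ (x≡1+m , _) | _ , x≢1+m  = x≢1+m x≡1+m

  swapEffect : ∀ w → distinct w ≡ true → All (_< suc (suc m)) w → topPairAtEnd w ≡ false → SwapEffect w
  swapEffect []          _ _ _  = same refl
  swapEffect (x ∷ [])    _ _ _  = same refl
  swapEffect (x ∷ y ∷ []) _ _ ne = same (cong (_∷ []) (shape-swap x y ne))
  swapEffect (x ∷ y ∷ z ∷ r) dist (x< ∷ y< ∷ z< ∷ r<) ne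
    with isTopPair x y in tp | swapEffect (y ∷ z ∷ r) (distinct-tail {x} {y ∷ z ∷ r} dist) (y< ∷ z< ∷ r<) ne
  ... | true  | same e =
    atStart (shapes (z ∷ r)) (topPair-flipped x y tp)
      (cong (λ s → shape x y ∷ s ∷ shapes (z ∷ r)) yz-down)
      (cong (shape (swap x) (swap y) ∷_) (trans e (cong (_∷ shapes (z ∷ r)) yz-down)))
      tp (proj₁ (topPair-occurs x y (z ∷ r) tp)) (proj₂ (topPair-occurs x y (z ∷ r) tp))
    where
    z≢x : z ≢ x
    z≢x = occurs-head-≢ z r (occurs-tail-false y (z ∷ r) (distinct-head {x} {y ∷ z ∷ r} dist))
    z≢y : z ≢ y
    z≢y = occurs-head-≢ z r (distinct-head {y} {z ∷ r} (distinct-tail {x} {y ∷ z ∷ r} dist))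
    z<m : z < m
    z<m with isTopPair-cases x y tp
    ... | inj₁ (refl , refl) = other-< z z< z≢x z≢y
    ... | inj₂ (refl , refl) = other-< z z< z≢y z≢x
    yz-down : shape y z ≡ down
    yz-down = shape-> (ℕ.<-≤-trans z<m (topPair-≥ʳ x y tp))
  ... | true  | atStart _ _ _ _ _ om o1+m = ⊥-elim (top-head-repeated x y (y ∷ z ∷ r) tp dist om o1+m)
  ... | true  | inside _ _ _ _ _ om o1+m  = ⊥-elim (top-head-repeated x y (y ∷ z ∷ r) tp dist om o1+m)
  ... | false | same e = same (cong₂ _∷_ (shape-swap x y tp) e)
  ... | false | atStart S fl e e′ tp′ om o1+m =
    inside [] S fl (cong₂ _∷_ xy-up e) (cong₂ _∷_ (trans (shape-swap x y tp) xy-up) e′)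
      (occurs-tail x (y ∷ z ∷ r) om) (occurs-tail x (y ∷ z ∷ r) o1+m)
    where
    xy-up : shape x y ≡ up
    xy-up = shape-< (ℕ.<-≤-trans (other-< x x< (proj₁ (head-not-top x (y ∷ z ∷ r) dist om o1+m))
                                                (proj₂ (head-not-top x (y ∷ z ∷ r) dist om o1+m)))
                                  (topPair-≥ˡ y z tp′))
  ... | false | inside P S fl e e′ om o1+m =
    inside (shape x y ∷ P) S fl (cong (shape x y ∷_) e) (cong₂ _∷_ (shape-swap x y tp) e′)
      (occurs-tail x (y ∷ z ∷ r) om) (occurs-tail x (y ∷ z ∷ r) o1+m)

  swap-preserves-statistics : ∀ w → distinct w ≡ true → All (_< suc (suc m)) w →
                              topPairAtStart w ≡ false → topPairAtEnd w ≡ false → SameStatistics (map swap w) w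
  swap-preserves-statistics w dist w< ns ne = same-statistics (map swap w) w (agree (swapEffect w dist w< ne))
    where
    agree : SwapEffect w → ∀ {B : Set} (Φ : List Shape → B) → HumpInvariant Φ → Φ (shapes (map swap w)) ≡ Φ (shapes w)
    agree (same e)                       Φ _   = cong Φ e
    agree (atStart _ _ _ _ ts _ _)       Φ _   with () ← trans (sym ts) ns
    agree (inside P S fl e e′ _ _)       Φ inv = trans (cong Φ e′) (trans (hump-flip Φ inv P S fl) (cong Φ (sym e)))

  mFirst : List ℕ → Bool
  mFirst []       = true
  mFirst (x ∷ xs) = if x ≡ᵇ m then true else (if x ≡ᵇ suc m then false else mFirst xs)

  mFirst-m : ∀ xs → mFirst (m ∷ xs) ≡ true
  mFirst-m xs rewrite ≡ᵇ-refl m = refl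

  mFirst-1+m : ∀ xs → mFirst (suc m ∷ xs) ≡ false
  mFirst-1+m xs rewrite ≡ᵇ-false 1+m≢m | ≡ᵇ-refl m = refl

  mFirst-other : ∀ x xs → x ≢ m → x ≢ suc m → mFirst (x ∷ xs) ≡ mFirst xs
  mFirst-other x xs x≢m x≢1+m rewrite ≡ᵇ-false x≢m | ≡ᵇ-false x≢1+m = refl

  mFirst-swap : ∀ w → occurs m w ≡ true → mFirst (map swap w) ≡ not (mFirst w)
  mFirst-swap (x ∷ xs) om with letter x
  ... | is-m refl rewrite swap-m     = trans (mFirst-1+m (map swap xs)) (cong not (sym (mFirst-m xs)))
  ... | is-1+m refl rewrite swap-1+m = trans (mFirst-m (map swap xs)) (cong not (sym (mFirst-1+m xs)))
  ... | other x≢m x≢1+m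
    rewrite swap-other x x≢m x≢1+m | mFirst-other x (map swap xs) x≢m x≢1+m | mFirst-other x xs x≢m x≢1+m
    = mFirst-swap xs (trans (sym (occurs-∷-≢ xs x≢m)) om)

  isTop : ℕ → ℕ → Bool
  isTop x y = (x ≡ᵇ m) ∧ (y ≡ᵇ suc m)

  isTop-≡ : ∀ {x y} → isTop x y ≡ true → x ≡ m × y ≡ suc m
  isTop-≡ {x} {y} t = ≡ᵇ-true⇒≡ (∧-conicalˡ (x ≡ᵇ m) _ t) , ≡ᵇ-true⇒≡ (∧-conicalʳ (x ≡ᵇ m) _ t)

  isTop-m : isTop m (suc m) ≡ true
  isTop-m rewrite ≡ᵇ-refl m = refl

  isTop-≢ˡ : ∀ {x} y → x ≢ m → isTop x y ≡ false
  isTop-≢ˡ y x≢m rewrite ≡ᵇ-false x≢m = refl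

  isTop-≢ʳ : ∀ {x y} → y ≢ suc m → isTop x y ≡ false
  isTop-≢ʳ {x} y≢1+m rewrite ≡ᵇ-false y≢1+m = ∧-zeroʳ (x ≡ᵇ m)

  startsWithTop endsWithTop : List ℕ → Bool
  startsWithTop (x ∷ y ∷ _) = isTop x y
  startsWithTop _           = false
  endsWithTop (x ∷ y ∷ [])         = isTop x y
  endsWithTop (_ ∷ xs@(_ ∷ _ ∷ _)) = endsWithTop xs
  endsWithTop _                    = false

  startsWithTop⇒mFirst : ∀ w → startsWithTop w ≡ true → mFirst w ≡ true
  startsWithTop⇒mFirst (x ∷ y ∷ r) t with isTop-≡ {x} {y} t
  ... | refl , refl = mFirst-m (suc m ∷ r)

  endsWithTop-occurs : ∀ w → endsWithTop w ≡ true → occurs m w ≡ true × occurs (suc m) w ≡ true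
  endsWithTop-occurs (x ∷ y ∷ []) t with isTop-≡ {x} {y} t
  ... | refl , refl = occurs-head m (suc m ∷ []) , occurs-tail m (suc m ∷ []) (occurs-head (suc m) [])
  endsWithTop-occurs (x ∷ y ∷ z ∷ r) t =
    let om , o1+m = endsWithTop-occurs (y ∷ z ∷ r) t
    in occurs-tail x (y ∷ z ∷ r) om , occurs-tail x (y ∷ z ∷ r) o1+m

  topPairAtEnd-occurs : ∀ w → topPairAtEnd w ≡ true → occurs m w ≡ true
  topPairAtEnd-occurs (x ∷ y ∷ [])    tp = proj₁ (topPair-occurs x y [] tp)
  topPairAtEnd-occurs (x ∷ y ∷ z ∷ r) tp = occurs-tail x (y ∷ z ∷ r) (topPairAtEnd-occurs (y ∷ z ∷ r) tp)

  endsWithTop⇒mFirst : ∀ w → distinct w ≡ true → endsWithTop w ≡ true → mFirst w ≡ true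
  endsWithTop⇒mFirst (x ∷ y ∷ []) _ t with isTop-≡ {x} {y} t
  ... | refl , refl = mFirst-m (suc m ∷ [])
  endsWithTop⇒mFirst (x ∷ w@(_ ∷ _ ∷ _)) dist t =
    prepend (letter x) (endsWithTop⇒mFirst w (distinct-tail {x} {w} dist) t)
    where
    prepend : Letter x → mFirst w ≡ true → mFirst (x ∷ w) ≡ true
    prepend (is-m x≡m)          _  = subst (λ u → mFirst (u ∷ w) ≡ true) (sym x≡m) (mFirst-m w)
    prepend (is-1+m x≡1+m)      _  =
      ⊥-elim (occurs-≢ {xs = w} (proj₂ (endsWithTop-occurs w t)) (distinct-head {x} {w} dist) (sym x≡1+m))
    prepend (other x≢m x≢1+m)   mf = trans (mFirst-other x w x≢m x≢1+m) mf

  startsWithTop⇒¬endsWithTop : ∀ x y z r → distinct (x ∷ y ∷ z ∷ r) ≡ true → startsWithTop (x ∷ y ∷ z ∷ r) ≡ true →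
                               endsWithTop (x ∷ y ∷ z ∷ r) ≡ false
  startsWithTop⇒¬endsWithTop x y z r dist s with endsWithTop (y ∷ z ∷ r) in e | isTop-≡ {x} {y} s
  ... | false | _          = refl
  ... | true  | refl , _   with () ← trans (sym (proj₁ (endsWithTop-occurs (y ∷ z ∷ r) e))) (distinct-head {m} {y ∷ z ∷ r} dist)

  mFirst-topPairAtStart : ∀ w → mFirst w ≡ true → topPairAtStart w ≡ true → startsWithTop w ≡ true
  mFirst-topPairAtStart (x ∷ y ∷ r) mf tp with isTopPair-cases x y tp
  ... | inj₁ (refl , refl) = isTop-m
  ... | inj₂ (refl , refl) with () ← trans (sym mf) (mFirst-1+m (m ∷ r))

  mFirst-topPairAtEnd : ∀ w → distinct w ≡ true → mFirst w ≡ true → topPairAtEnd w ≡ true → endsWithTop w ≡ true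
  mFirst-topPairAtEnd (x ∷ y ∷ []) _ mf tp with isTopPair-cases x y tp
  ... | inj₁ (refl , refl) = isTop-m
  ... | inj₂ (refl , refl) with () ← trans (sym mf) (mFirst-1+m (m ∷ []))
  mFirst-topPairAtEnd (x ∷ w@(_ ∷ _ ∷ _)) dist mf tp =
    prepend (letter x) (λ mf′ → mFirst-topPairAtEnd w (distinct-tail {x} {w} dist) mf′ tp)
    where
    prepend : Letter x → (mFirst w ≡ true → endsWithTop w ≡ true) → endsWithTop (x ∷ w) ≡ true
    prepend (is-m x≡m)        _   =
      ⊥-elim (occurs-≢ {xs = w} (topPairAtEnd-occurs w tp) (distinct-head {x} {w} dist) (sym x≡m))
    prepend (is-1+m x≡1+m)    _   with () ← trans (sym mf) (subst (λ u → mFirst (u ∷ w) ≡ false) (sym x≡1+m) (mFirst-1+m w))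
    prepend (other x≢m x≢1+m) rec = rec (trans (sym (mFirst-other x w x≢m x≢1+m)) mf)

  below-high : ∀ x X Y → x < m → m ≤ X → m ≤ Y → below x (X ∷ Y ∷ []) ≡ 0
  below-high x X Y x<m m≤X m≤Y
    rewrite <ᵇ-false {X} {x} (ℕ.<⇒≤ (ℕ.<-≤-trans x<m m≤X)) | <ᵇ-false {Y} {x} (ℕ.<⇒≤ (ℕ.<-≤-trans x<m m≤Y)) = refl

  inv-high-∷ : ∀ X Y r → All (_< m) r → m ≤ X → m ≤ Y →
               inv (X ∷ Y ∷ r) ≡ inv (X ∷ Y ∷ []) + (length r + (length r + inv r))
  inv-high-∷ X Y r r<m m≤X m≤Y = begin
    inv (X ∷ Y ∷ r)                                   ≡⟨ inv-∷ X (Y ∷ r) ⟩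
    below X (Y ∷ r) + inv (Y ∷ r)                     ≡⟨ cong (below X (Y ∷ r) +_) (inv-∷ Y r) ⟩
    (b2n (Y <ᵇ X) + below X r) + (below Y r + inv r)  ≡⟨ cong₂ (λ u v → (b2n (Y <ᵇ X) + u) + (v + inv r))
                                                               (below-low X r (All-≤ m≤X)) (below-low Y r (All-≤ m≤Y)) ⟩
    (b2n (Y <ᵇ X) + L) + (L + inv r)                  ≡⟨ regroup (b2n (Y <ᵇ X)) L (inv r) ⟩
    inv (X ∷ Y ∷ []) + (L + (L + inv r))              ∎
    where
    open ≡-Reasoning
    L = length r
    All-≤ : ∀ {Z} → m ≤ Z → All (_< Z) r
    All-≤ m≤Z = All.map (λ x<m → ℕ.<-≤-trans x<m m≤Z) r<m
    regroup : ∀ A B C → (A + B) + (B + C) ≡ ((A + 0) + 0) + (B + (B + C))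
    regroup = solve-∀

  inv-++-high : ∀ r X Y → All (_< m) r → m ≤ X → m ≤ Y → inv (r ++ X ∷ Y ∷ []) ≡ inv r + inv (X ∷ Y ∷ [])
  inv-++-high []      X Y []           m≤X m≤Y = refl
  inv-++-high (x ∷ r) X Y (x<m ∷ r<m) m≤X m≤Y = begin
    inv (x ∷ (r ++ X ∷ Y ∷ []))                            ≡⟨ inv-∷ x (r ++ X ∷ Y ∷ []) ⟩
    below x (r ++ X ∷ Y ∷ []) + inv (r ++ X ∷ Y ∷ [])      ≡⟨ cong₂ _+_ (below-++ x r (X ∷ Y ∷ [])) (inv-++-high r X Y r<m m≤X m≤Y) ⟩
    (below x r + below x (X ∷ Y ∷ [])) + (inv r + inv (X ∷ Y ∷ []))
      ≡⟨ cong (λ v → (below x r + v) + (inv r + inv (X ∷ Y ∷ []))) (below-high x X Y x<m m≤X m≤Y) ⟩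
    (below x r + 0) + (inv r + inv (X ∷ Y ∷ []))           ≡⟨ regroup (below x r) (inv r) (inv (X ∷ Y ∷ [])) ⟩
    (below x r + inv r) + inv (X ∷ Y ∷ [])                 ≡⟨ cong (_+ inv (X ∷ Y ∷ [])) (inv-∷ x r) ⟨
    inv (x ∷ r) + inv (X ∷ Y ∷ [])                         ∎
    where
    open ≡-Reasoning
    regroup : ∀ A B C → (A + 0) + (B + C) ≡ (A + B) + C
    regroup = solve-∀

  inv-m-1+m : inv (m ∷ suc m ∷ []) ≡ 0
  inv-m-1+m rewrite <ᵇ-false {suc m} {m} (ℕ.n≤1+n m) = refl

  inv-1+m-m : inv (suc m ∷ m ∷ []) ≡ 1
  inv-1+m-m rewrite <ᵇ-true m<1+m = refl

  pk-high-∷ : ∀ X Y r₁ r₂ r → r₁ < m → m ≤ Y → pk (X ∷ Y ∷ r₁ ∷ r₂ ∷ r) ≡ b2n (X <ᵇ Y) + pk (r₁ ∷ r₂ ∷ r)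
  pk-high-∷ X Y r₁ r₂ r r₁<m m≤Y
    rewrite <ᵇ-true (ℕ.<-≤-trans r₁<m m≤Y) | <ᵇ-false {Y} {r₁} (ℕ.<⇒≤ (ℕ.<-≤-trans r₁<m m≤Y))
          | ∧-identityʳ (X <ᵇ Y) = refl

  val-high-∷ : ∀ X Y r₁ r₂ r → r₁ < m → m ≤ Y → val (X ∷ Y ∷ r₁ ∷ r₂ ∷ r) ≡ b2n (r₁ <ᵇ r₂) + val (r₁ ∷ r₂ ∷ r)
  val-high-∷ X Y r₁ r₂ r r₁<m m≤Y
    rewrite <ᵇ-true (ℕ.<-≤-trans r₁<m m≤Y) | <ᵇ-false {Y} {r₁} (ℕ.<⇒≤ (ℕ.<-≤-trans r₁<m m≤Y))
          | ∧-zeroʳ (Y <ᵇ X) = refl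

  pk-++-high : ∀ r₁ r₂ r X Y → All (_< m) (r₁ ∷ r₂ ∷ r) → m ≤ X →
               pk (r₁ ∷ r₂ ∷ (r ++ X ∷ Y ∷ [])) ≡ pk (r₁ ∷ r₂ ∷ r) + b2n (Y <ᵇ X)
  pk-++-high r₁ r₂ []       X Y (_ ∷ r₂<m ∷ []) m≤X
    rewrite <ᵇ-false {X} {r₂} (ℕ.<⇒≤ (ℕ.<-≤-trans r₂<m m≤X)) | <ᵇ-true (ℕ.<-≤-trans r₂<m m≤X)
          | ∧-zeroʳ (r₁ <ᵇ r₂) = ℕ.+-identityʳ _
  pk-++-high r₁ r₂ (r₃ ∷ r) X Y (_ ∷ r<m) m≤X
    rewrite pk-++-high r₂ r₃ r X Y r<m m≤X = sym (ℕ.+-assoc (b2n ((r₁ <ᵇ r₂) ∧ (r₃ <ᵇ r₂))) _ _)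

  val-++-high : ∀ r₁ r₂ r X Y → All (_< m) (r₁ ∷ r₂ ∷ r) → m ≤ X →
                val (r₁ ∷ r₂ ∷ (r ++ X ∷ Y ∷ [])) ≡ val (r₁ ∷ r₂ ∷ r) + b2n (endsInDescent (r₁ ∷ r₂ ∷ r))
  val-++-high r₁ r₂ []       X Y (_ ∷ r₂<m ∷ []) m≤X
    rewrite <ᵇ-false {X} {r₂} (ℕ.<⇒≤ (ℕ.<-≤-trans r₂<m m≤X)) | <ᵇ-true (ℕ.<-≤-trans r₂<m m≤X)
          | ∧-identityʳ (r₂ <ᵇ r₁) = ℕ.+-identityʳ _
  val-++-high r₁ r₂ (r₃ ∷ r) X Y (_ ∷ r<m) m≤X
    rewrite val-++-high r₂ r₃ r X Y r<m m≤X = sym (ℕ.+-assoc (b2n ((r₂ <ᵇ r₁) ∧ (r₂ <ᵇ r₃))) _ _)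

  endsWithTop-++ : ∀ r X Y → endsWithTop (r ++ X ∷ Y ∷ []) ≡ isTop X Y
  endsWithTop-++ []              X Y = refl
  endsWithTop-++ (x ∷ [])        X Y = refl
  endsWithTop-++ (x ∷ y ∷ [])    X Y = refl
  endsWithTop-++ (x ∷ y ∷ z ∷ r) X Y = endsWithTop-++ (y ∷ z ∷ r) X Y

  high-≢-low : ∀ {X x} → m ≤ X → x < m → X ≢ x
  high-≢-low m≤X x<m refl = ℕ.<⇒≱ x<m m≤X

  distinct-high-∷ : ∀ X Y r → All (_< m) r → m ≤ X → m ≤ Y → X ≢ Y → distinct (X ∷ Y ∷ r) ≡ distinct r
  distinct-high-∷ X Y r r<m m≤X m≤Y X≢Y
    rewrite ≡ᵇ-false (λ Y≡X → X≢Y (sym Y≡X)) | occurs-≥ r<m m≤X | occurs-≥ r<m m≤Y = refl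

  distinct-++-high : ∀ r X Y → All (_< m) r → m ≤ X → m ≤ Y → X ≢ Y → distinct (r ++ X ∷ Y ∷ []) ≡ distinct r
  distinct-++-high []      X Y []           m≤X m≤Y X≢Y rewrite ≡ᵇ-false (λ Y≡X → X≢Y (sym Y≡X)) = refl
  distinct-++-high (x ∷ r) X Y (x<m ∷ r<m) m≤X m≤Y X≢Y
    rewrite occurs-++ x r (X ∷ Y ∷ []) | ≡ᵇ-false (high-≢-low m≤X x<m) | ≡ᵇ-false (high-≢-low m≤Y x<m)
          | ∨-identityʳ (occurs x r) | distinct-++-high r X Y r<m m≤X m≤Y X≢Y = refl

  distinct-top-∷ : ∀ r → All (_< m) r → distinct (m ∷ suc m ∷ r) ≡ distinct r
  distinct-top-∷ r r<m = distinct-high-∷ m (suc m) r r<m ℕ.≤-refl (ℕ.n≤1+n m) m≢1+m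

  distinct-++-top : ∀ r → All (_< m) r → distinct (r ++ m ∷ suc m ∷ []) ≡ distinct r
  distinct-++-top r r<m = distinct-++-high r m (suc m) r<m ℕ.≤-refl (ℕ.n≤1+n m) m≢1+m

module Sums {c ℓ : Level} (R : CommutativeRing c ℓ) where
  open import Data.Nat using (ℕ; zero; suc; _<_; z≤n; s≤s)
  import Data.Nat.Properties as ℕ
  open import Data.Bool using (true; false; if_then_else_)
  open import Data.List using (List; []; _∷_; map; length; _++_; concatMap; filter; tabulate; allFin)
  import Data.List.Properties as List
  open import Data.List.Relation.Unary.All using (All; []; _∷_)
  open import Data.Fin using (Fin; toℕ)
  open import Data.Vec using (Vec)
  import Data.Vec
  open import Function using (_∘_)
  open import Relation.Nullary using (does)
  open import Relation.Unary using (Pred; Decidable)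
  open import Relation.Binary.PropositionalEquality as ≡ using (_≡_; _≢_)
  open Words

  open CommutativeRing R
  open import Algebra.Properties.CommutativeSemigroup +-commutativeSemigroup using (interchange)
  open import Relation.Binary.Reasoning.Setoid setoid

  sumBelow : ℕ → (ℕ → Carrier) → Carrier
  sumBelow zero    f = 0#
  sumBelow (suc n) f = f 0 + sumBelow n (λ x → f (suc x))

  sumBelow-cong : ∀ N {f g} → (∀ x → x < N → f x ≈ g x) → sumBelow N f ≈ sumBelow N g
  sumBelow-cong zero    f≈g = refl
  sumBelow-cong (suc N) f≈g = +-cong (f≈g 0 (s≤s z≤n)) (sumBelow-cong N (λ x x<N → f≈g (suc x) (s≤s x<N)))

  sumBelow-zero : ∀ N {f} → (∀ x → x < N → f x ≈ 0#) → sumBelow N f ≈ 0#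
  sumBelow-zero zero    f≈0 = refl
  sumBelow-zero (suc N) f≈0 =
    trans (+-cong (f≈0 0 (s≤s z≤n)) (sumBelow-zero N (λ x x<N → f≈0 (suc x) (s≤s x<N)))) (+-identityˡ 0#)

  sumBelow-+ : ∀ N f g → sumBelow N (λ x → f x + g x) ≈ sumBelow N f + sumBelow N g
  sumBelow-+ zero    f g = sym (+-identityˡ 0#)
  sumBelow-+ (suc N) f g = trans (+-congˡ (sumBelow-+ N (λ x → f (suc x)) (λ x → g (suc x)))) (interchange _ _ _ _)

  sumBelow-snoc : ∀ N f → sumBelow (suc N) f ≈ sumBelow N f + f N
  sumBelow-snoc zero    f = +-comm _ _
  sumBelow-snoc (suc N) f = trans (+-congˡ (sumBelow-snoc N (λ x → f (suc x)))) (sym (+-assoc _ _ _))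

  sumBelow-single : ∀ N t {f} → t < N → (∀ x → x < N → x ≢ t → f x ≈ 0#) → sumBelow N f ≈ f t
  sumBelow-single (suc N) zero    t<N f≈0 =
    trans (+-congˡ (sumBelow-zero N (λ x x<N → f≈0 (suc x) (s≤s x<N) (λ ())))) (+-identityʳ _)
  sumBelow-single (suc N) (suc t) (s≤s t<N) f≈0 =
    trans (+-cong (f≈0 0 (s≤s z≤n) (λ ()))
                  (sumBelow-single N t t<N (λ x x<N x≢t → f≈0 (suc x) (s≤s x<N) (λ e → x≢t (ℕ.suc-injective e)))))
          (+-identityˡ _)

  sumBelow-comm : ∀ A B (f : ℕ → ℕ → Carrier) →
                  sumBelow A (λ x → sumBelow B (f x)) ≈ sumBelow B (λ y → sumBelow A (λ x → f x y))
  sumBelow-comm zero    B f = sym (sumBelow-zero B (λ _ _ → refl))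
  sumBelow-comm (suc A) B f =
    trans (+-congˡ (sumBelow-comm A B (λ x → f (suc x)))) (sym (sumBelow-+ B (f 0) (λ y → sumBelow A (λ x → f (suc x) y))))

  sumBelow-swap : ∀ m f → sumBelow (suc (suc m)) f ≈ sumBelow (suc (suc m)) (λ x → f (TopSwap.swap m x))
  sumBelow-swap m f = begin
    sumBelow (suc (suc m)) f        ≈⟨ sumBelow-snoc (suc m) f ⟩
    sumBelow (suc m) f + f (suc m)  ≈⟨ +-congʳ (sumBelow-snoc m f) ⟩
    (sumBelow m f + f m) + f (suc m) ≈⟨ +-assoc _ _ _ ⟩
    sumBelow m f + (f m + f (suc m)) ≈⟨ +-cong (sumBelow-cong m (λ x x<m → reflexive (≡.cong f (≡.sym (swap-< x x<m)))))
                                               (+-comm _ _) ⟩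
    sumBelow m g + (f (suc m) + f m) ≈⟨ +-congˡ (+-cong (reflexive (≡.cong f (≡.sym swap-m))) (reflexive (≡.cong f (≡.sym swap-1+m)))) ⟩
    sumBelow m g + (g m + g (suc m)) ≈⟨ +-assoc _ _ _ ⟨
    (sumBelow m g + g m) + g (suc m) ≈⟨ +-congʳ (sumBelow-snoc m g) ⟨
    sumBelow (suc m) g + g (suc m)  ≈⟨ sumBelow-snoc (suc m) g ⟨
    sumBelow (suc (suc m)) g        ∎
    where
    open TopSwap m using (swap; swap-<; swap-m; swap-1+m)
    g = λ x → f (swap x)

  sumWords : ℕ → ℕ → (List ℕ → Carrier) → Carrier
  sumWords zero    N h = h []
  sumWords (suc L) N h = sumWords L N (λ w → sumBelow N (λ x → h (x ∷ w)))

  sumWords-cong : ∀ L N {f g} → (∀ w → length w ≡ L → All (_< N) w → f w ≈ g w) → sumWords L N f ≈ sumWords L N g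
  sumWords-cong zero    N f≈g = f≈g [] ≡.refl []
  sumWords-cong (suc L) N f≈g =
    sumWords-cong L N (λ w len w<N → sumBelow-cong N (λ x x<N → f≈g (x ∷ w) (≡.cong suc len) (x<N ∷ w<N)))

  sumWords-cong′ : ∀ L N {f g} → (∀ w → f w ≈ g w) → sumWords L N f ≈ sumWords L N g
  sumWords-cong′ L N f≈g = sumWords-cong L N (λ w _ _ → f≈g w)

  sumWords-+ : ∀ L N f g → sumWords L N (λ w → f w + g w) ≈ sumWords L N f + sumWords L N g
  sumWords-+ zero    N f g = refl
  sumWords-+ (suc L) N f g =
    trans (sumWords-cong′ L N (λ w → sumBelow-+ N (λ x → f (x ∷ w)) (λ x → g (x ∷ w))))
          (sumWords-+ L N (λ w → sumBelow N (λ x → f (x ∷ w))) (λ w → sumBelow N (λ x → g (x ∷ w))))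

  sumWords-swap : ∀ L m h → sumWords L (suc (suc m)) h ≈ sumWords L (suc (suc m)) (λ w → h (map (TopSwap.swap m) w))
  sumWords-swap zero    m h = refl
  sumWords-swap (suc L) m h =
    trans (sumWords-swap L m (λ w → sumBelow (suc (suc m)) (λ x → h (x ∷ w))))
          (sumWords-cong′ L (suc (suc m)) (λ w → sumBelow-swap m (λ x → h (x ∷ map (TopSwap.swap m) w))))

  sumWords-snoc : ∀ L N h → sumWords (suc L) N h ≈ sumWords L N (λ r → sumBelow N (λ x → h (r ++ x ∷ [])))
  sumWords-snoc zero    N h = refl
  sumWords-snoc (suc L) N h =
    trans (sumWords-snoc L N (λ w → sumBelow N (λ y → h (y ∷ w))))
          (sumWords-cong′ L N (λ r → sumBelow-comm N N (λ x y → h (y ∷ (r ++ x ∷ [])))))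

  sumWords-shrink : ∀ L N h → (∀ w → occurs N w ≡ true → h w ≈ 0#) → sumWords L (suc N) h ≈ sumWords L N h
  sumWords-shrink zero    N h h≈0 = refl
  sumWords-shrink (suc L) N h h≈0 =
    trans (sumWords-shrink L N k k≈0)
          (sumWords-cong′ L N (λ w → trans (sumBelow-snoc N (λ x → h (x ∷ w)))
                                          (trans (+-congˡ (h≈0 (N ∷ w) (occurs-head N w))) (+-identityʳ _))))
    where
    k = λ w → sumBelow (suc N) (λ x → h (x ∷ w))
    k≈0 : ∀ w → occurs N w ≡ true → k w ≈ 0#
    k≈0 w o = sumBelow-zero (suc N) (λ x _ → h≈0 (x ∷ w) (occurs-tail x w o))

  sumR-++ : ∀ {A : Set} (f : A → Carrier) xs ys → sumR R (map f (xs ++ ys)) ≈ sumR R (map f xs) + sumR R (map f ys)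
  sumR-++ f []       ys = sym (+-identityˡ _)
  sumR-++ f (x ∷ xs) ys = trans (+-congˡ (sumR-++ f xs ys)) (sym (+-assoc _ _ _))

  sumR-concatMap : ∀ {A B : Set} (f : B → Carrier) (g : A → List B) xs →
                   sumR R (map f (concatMap g xs)) ≈ sumR R (map (λ x → sumR R (map f (g x))) xs)
  sumR-concatMap f g []       = refl
  sumR-concatMap f g (x ∷ xs) = trans (sumR-++ f (g x) (concatMap g xs)) (+-congˡ (sumR-concatMap f g xs))

  sumR-cong : ∀ {A : Set} {f g : A → Carrier} xs → (∀ x → f x ≈ g x) → sumR R (map f xs) ≈ sumR R (map g xs)
  sumR-cong []       f≈g = refl
  sumR-cong (x ∷ xs) f≈g = +-cong (f≈g x) (sumR-cong xs f≈g)

  sumR-allFin : ∀ N (f : ℕ → Carrier) → sumR R (map (λ i → f (toℕ i)) (allFin N)) ≈ sumBelow N f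
  sumR-allFin N f = trans (reflexive (≡.cong (sumR R) (List.map-tabulate {n = N} (λ i → i) (λ i → f (toℕ i))))) (tabulated N f)
    where
    tabulated : ∀ N (f : ℕ → Carrier) → sumR R (tabulate {n = N} (λ i → f (toℕ i))) ≈ sumBelow N f
    tabulated zero    f = refl
    tabulated (suc N) f = +-congˡ (tabulated N (λ x → f (suc x)))

  sumR-allVecs : ∀ L N (h : List ℕ → Carrier) → sumR R (map (λ v → h (wordOf v)) (allVecs L N)) ≈ sumWords L N h
  sumR-allVecs zero    N h = +-identityʳ _
  sumR-allVecs (suc L) N h = begin
    sumR R (map (h ∘ wordOf) (concatMap extend (allVecs L N)))
      ≈⟨ sumR-concatMap (h ∘ wordOf) extend (allVecs L N) ⟩
    sumR R (map (λ v → sumR R (map (h ∘ wordOf) (extend v))) (allVecs L N))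
      ≈⟨ sumR-cong (allVecs L N) (λ v → trans (reflexive (≡.cong (sumR R) (≡.sym (List.map-∘ (allFin N)))))
                                               (sumR-allFin N (λ y → h (y ∷ wordOf v)))) ⟩
    sumR R (map (λ v → sumBelow N (λ y → h (y ∷ wordOf v))) (allVecs L N))
      ≈⟨ sumR-allVecs L N (λ w → sumBelow N (λ y → h (y ∷ w))) ⟩
    sumWords (suc L) N h ∎
    where
    extend : Vec (Fin N) L → List (Vec (Fin N) (suc L))
    extend v = map (Data.Vec._∷ v) (allFin N)

  sumR-filter : ∀ {A : Set} {p} {P : Pred A p} (P? : Decidable P) (f : A → Carrier) xs →
                sumR R (map f (filter P? xs)) ≈ sumR R (map (λ v → if does (P? v) then f v else 0#) xs)
  sumR-filter P? f []       = refl
  sumR-filter P? f (x ∷ xs) with does (P? x)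
  ... | true  = +-congˡ (sumR-filter P? f xs)
  ... | false = trans (sumR-filter P? f xs) (sym (+-identityˡ _))

  sumR-perms : ∀ n (f : List ℕ → Carrier) →
               sumR R (map (λ v → f (word v)) (perms n)) ≈ sumWords n n (λ w → if distinct w then f w else 0#)
  sumR-perms n f = begin
    sumR R (map (λ v → f (word v)) (filter isPerm? (allVecs n n)))
      ≈⟨ sumR-filter isPerm? (λ v → f (word v)) (allVecs n n) ⟩
    sumR R (map (λ v → if does (isPerm? v) then f (word v) else 0#) (allVecs n n))
      ≈⟨ sumR-cong (allVecs n n) (λ v → reflexive (≡.cong (λ b → if b then f (word v) else 0#) (isPerm?-distinct v))) ⟩
    sumR R (map (λ v → if distinct (word v) then f (word v) else 0#) (allVecs n n))
      ≈⟨ sumR-allVecs n n (λ w → if distinct w then f w else 0#) ⟩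
    sumWords n n (λ w → if distinct w then f w else 0#) ∎

module Recurrence {c ℓ : Level} (R : CommutativeRing c ℓ) (p q : CommutativeRing.Carrier R) where
  open import Data.Nat as ℕ using (ℕ; zero; suc; _<_; _<ᵇ_)
  import Data.Nat.Properties as ℕ
  open import Data.Bool using (Bool; true; false; _∧_; if_then_else_)
  open import Data.List using (List; []; _∷_; map; length; _++_)
  import Data.List.Properties as List
  open import Data.List.Relation.Unary.All using (All; []; _∷_)
  open import Data.Product using (proj₁; proj₂)
  open import Data.Sum using (_⊎_; inj₁; inj₂)
  open import Data.Integer using (+_)
  open import Relation.Binary.PropositionalEquality as ≡ using (_≡_)
  open Words
  open Statistics

  open CommutativeRing R
  open import Algebra.Properties.Ring ring using (-1*x≈-x; -‿involutive)
  open import Relation.Binary.Reasoning.Setoid setoid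
  open Sums R
  open ℤ-CoefficientSolver R using (solve; _:=_; _:+_; _:*_; :-_; _:-_; con; Polynomial)

  1̂ 0̂ 2̂ : ∀ {n} → Polynomial n
  1̂ = con (+ 1)
  0̂ = con (+ 0)
  2̂ = 1̂ :+ 1̂

  wt : List ℕ → Carrier
  wt = weight R p q

  wt-≡ : ∀ w {i k v} → inv w ≡ i → pk w ≡ k → val w ≡ v → wt w ≡ pow R (- 1#) i * (pow R p k * pow R q v)
  wt-≡ w ≡.refl ≡.refl ≡.refl = ≡.refl

  wt-opposite : ∀ v w → (inv v ≡ suc (inv w)) ⊎ (inv w ≡ suc (inv v)) → pk v ≡ pk w → val v ≡ val w → wt v ≈ - wt w
  wt-opposite v w (inj₁ inv-v) pk≡ val≡ = begin
    wt v                                                        ≡⟨ wt-≡ v inv-v pk≡ val≡ ⟩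
    (- 1# * pow R (- 1#) (inv w)) * (pow R p (pk w) * pow R q (val w)) ≈⟨ *-assoc _ _ _ ⟩
    - 1# * wt w                                                 ≈⟨ -1*x≈-x _ ⟩
    - wt w                                                      ∎
  wt-opposite v w (inj₂ inv-w) pk≡ val≡ = begin
    wt v      ≈⟨ -‿involutive _ ⟨
    - - wt v  ≈⟨ -‿cong (wt-opposite w v (inj₁ inv-w) (≡.sym pk≡) (≡.sym val≡)) ⟨
    - wt w    ∎

  term : (AD → AD → Carrier) → List ℕ → Carrier
  term φ w = if distinct w then φ (firstPair w) (lastPair w) * wt w else 0#

  total : (AD → AD → Carrier) → ℕ → Carrier
  total φ n = sumWords n n (term φ)

  term-distinct : ∀ φ w → distinct w ≡ true → term φ w ≡ φ (firstPair w) (lastPair w) * wt w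
  term-distinct φ w dist rewrite dist = ≡.refl

  term-repeated : ∀ φ w → distinct w ≡ false → term φ w ≡ 0#
  term-repeated φ w dist rewrite dist = ≡.refl

  indicator : AD → AD → AD → AD → Carrier
  indicator x y u v = if adEq u x ∧ adEq v y then 1# else 0#

  SgnAltrunXY≈total : ∀ n x y → SgnAltrunXY R n x y p q ≈ total (indicator x y) n
  SgnAltrunXY≈total n x y = trans (sumR-perms n selected) (sumWords-cong′ n n selected≈term)
    where
    selected : List ℕ → Carrier
    selected w = if adEq (firstPair w) x ∧ adEq (lastPair w) y then wt w else 0#
    selected≈term : ∀ w → (if distinct w then selected w else 0#) ≈ term (indicator x y) w
    selected≈term w with distinct w | adEq (firstPair w) x ∧ adEq (lastPair w) y
    ... | false | _     = refl
    ... | true  | true  = sym (*-identityˡ _)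
    ... | true  | false = sym (zeroˡ _)

  SgnAltrun≈total : ∀ n → SgnAltrun R n p q ≈ total (λ _ _ → 1#) n
  SgnAltrun≈total n = trans (sumR-perms n wt) (sumWords-cong′ n n wt≈term)
    where
    wt≈term : ∀ w → (if distinct w then wt w else 0#) ≈ term (λ _ _ → 1#) w
    wt≈term w with distinct w
    ... | false = refl
    ... | true  = sym (*-identityˡ _)

  sign-even : ∀ L i → pow R (- 1#) (L ℕ.+ (L ℕ.+ i)) ≈ pow R (- 1#) i
  sign-even zero    i = refl
  sign-even (suc L) i = begin
    - 1# * pow R (- 1#) (L ℕ.+ suc (L ℕ.+ i))          ≡⟨ ≡.cong (λ k → - 1# * pow R (- 1#) k) (ℕ.+-suc L (L ℕ.+ i)) ⟩
    - 1# * (- 1# * pow R (- 1#) (L ℕ.+ (L ℕ.+ i)))     ≈⟨ -1*x≈-x _ ⟩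
    - (- 1# * pow R (- 1#) (L ℕ.+ (L ℕ.+ i)))          ≈⟨ -‿cong (-1*x≈-x _) ⟩
    - - pow R (- 1#) (L ℕ.+ (L ℕ.+ i))                 ≈⟨ -‿involutive _ ⟩
    pow R (- 1#) (L ℕ.+ (L ℕ.+ i))                     ≈⟨ sign-even L i ⟩
    pow R (- 1#) i                                     ∎

  pow-b2n : ∀ x b v → pow R x (b2n b ℕ.+ v) ≈ (if b then x else 1#) * pow R x v
  pow-b2n x true  v = refl
  pow-b2n x false v = sym (*-identityˡ _)

  frontFactor backFactor : AD → Carrier
  frontFactor a = q
  frontFactor d = 1#
  backFactor a = 1#
  backFactor d = q

  -- Contribution of the permutations of n + 2 whose two largest letters are adjacent at the start
  -- (first summand) or at the end (second summand), as a weight on the permutations of n.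
  step : (AD → AD → Carrier) → AD → AD → Carrier
  step φ x y = frontFactor x * (p * φ a y - φ d y) + backFactor y * (φ x a - p * φ x d)

  module Boundary (m : ℕ) where
    open TopSwap m

    ascentFactor : ℕ → ℕ → Carrier
    ascentFactor r₁ r₂ = if r₁ <ᵇ r₂ then q else 1#

    frontFactor-firstPair : ∀ r₁ r₂ r → frontFactor (firstPair (r₁ ∷ r₂ ∷ r)) ≡ ascentFactor r₁ r₂
    frontFactor-firstPair r₁ r₂ r with r₁ <ᵇ r₂
    ... | true  = ≡.refl
    ... | false = ≡.refl

    descentFactor : List ℕ → Carrier
    descentFactor r = if endsInDescent r then q else 1#

    backFactor-lastPair : ∀ r₁ r₂ r → distinct (r₁ ∷ r₂ ∷ r) ≡ true →
                          backFactor (lastPair (r₁ ∷ r₂ ∷ r)) ≡ descentFactor (r₁ ∷ r₂ ∷ r)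
    backFactor-lastPair r₁ r₂ r dist rewrite lastPair-endsInDescent r₁ r₂ r dist with endsInDescent (r₁ ∷ r₂ ∷ r)
    ... | true  = ≡.refl
    ... | false = ≡.refl

    wt-top-∷ : ∀ r₁ r₂ r → All (_< m) (r₁ ∷ r₂ ∷ r) →
               wt (m ∷ suc m ∷ r₁ ∷ r₂ ∷ r) ≈ p * (ascentFactor r₁ r₂ * wt (r₁ ∷ r₂ ∷ r))
    wt-top-∷ r₁ r₂ r r₀<m@(r₁<m ∷ _) = begin
      wt (m ∷ suc m ∷ r₀)
        ≡⟨ wt-≡ (m ∷ suc m ∷ r₀)
                (≡.trans (inv-high-∷ m (suc m) r₀ r₀<m ℕ.≤-refl (ℕ.n≤1+n m))
                         (≡.cong (ℕ._+ (L ℕ.+ (L ℕ.+ inv r₀))) inv-m-1+m))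
                (≡.trans (pk-high-∷ m (suc m) r₁ r₂ r r₁<m (ℕ.n≤1+n m))
                         (≡.cong (λ b → b2n b ℕ.+ pk r₀) (<ᵇ-true m<1+m)))
                (val-high-∷ m (suc m) r₁ r₂ r r₁<m (ℕ.n≤1+n m)) ⟩
      pow R (- 1#) (L ℕ.+ (L ℕ.+ inv r₀)) * (pow R p (suc (pk r₀)) * pow R q (b2n (r₁ <ᵇ r₂) ℕ.+ val r₀))
        ≈⟨ *-cong (sign-even L (inv r₀)) (*-congˡ (pow-b2n q (r₁ <ᵇ r₂) (val r₀))) ⟩
      pow R (- 1#) (inv r₀) * ((p * pow R p (pk r₀)) * (ascentFactor r₁ r₂ * pow R q (val r₀)))
        ≈⟨ regroup _ _ _ _ ⟩
      p * (ascentFactor r₁ r₂ * wt r₀) ∎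
      where
      r₀ = r₁ ∷ r₂ ∷ r
      L = length r₀
      regroup : ∀ s P c Q → s * ((p * P) * (c * Q)) ≈ p * (c * (s * (P * Q)))
      regroup = solve 5 (λ p s P c Q → s :* ((p :* P) :* (c :* Q)) := p :* (c :* (s :* (P :* Q)))) refl p

    wt-top′-∷ : ∀ r₁ r₂ r → All (_< m) (r₁ ∷ r₂ ∷ r) →
                wt (suc m ∷ m ∷ r₁ ∷ r₂ ∷ r) ≈ - (ascentFactor r₁ r₂ * wt (r₁ ∷ r₂ ∷ r))
    wt-top′-∷ r₁ r₂ r r₀<m@(r₁<m ∷ _) = begin
      wt (suc m ∷ m ∷ r₀)
        ≡⟨ wt-≡ (suc m ∷ m ∷ r₀)
                (≡.trans (inv-high-∷ (suc m) m r₀ r₀<m (ℕ.n≤1+n m) ℕ.≤-refl)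
                         (≡.cong (ℕ._+ (L ℕ.+ (L ℕ.+ inv r₀))) inv-1+m-m))
                (≡.trans (pk-high-∷ (suc m) m r₁ r₂ r r₁<m ℕ.≤-refl)
                         (≡.cong (λ b → b2n b ℕ.+ pk r₀) (<ᵇ-false (ℕ.n≤1+n m))))
                (val-high-∷ (suc m) m r₁ r₂ r r₁<m ℕ.≤-refl) ⟩
      (- 1# * pow R (- 1#) (L ℕ.+ (L ℕ.+ inv r₀))) * (pow R p (pk r₀) * pow R q (b2n (r₁ <ᵇ r₂) ℕ.+ val r₀))
        ≈⟨ *-cong (*-congˡ (sign-even L (inv r₀))) (*-congˡ (pow-b2n q (r₁ <ᵇ r₂) (val r₀))) ⟩
      (- 1# * pow R (- 1#) (inv r₀)) * (pow R p (pk r₀) * (ascentFactor r₁ r₂ * pow R q (val r₀)))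
        ≈⟨ regroup _ _ _ _ ⟩
      - (ascentFactor r₁ r₂ * wt r₀) ∎
      where
      r₀ = r₁ ∷ r₂ ∷ r
      L = length r₀
      regroup : ∀ s P c Q → (- 1# * s) * (P * (c * Q)) ≈ - (c * (s * (P * Q)))
      regroup = solve 4 (λ s P c Q → ((:- 1̂) :* s) :* (P :* (c :* Q)) := :- (c :* (s :* (P :* Q)))) refl

    wt-++-top : ∀ r₁ r₂ r → All (_< m) (r₁ ∷ r₂ ∷ r) →
                wt ((r₁ ∷ r₂ ∷ r) ++ m ∷ suc m ∷ []) ≈ descentFactor (r₁ ∷ r₂ ∷ r) * wt (r₁ ∷ r₂ ∷ r)
    wt-++-top r₁ r₂ r r₀<m = begin
      wt (r₀ ++ m ∷ suc m ∷ [])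
        ≡⟨ wt-≡ (r₀ ++ m ∷ suc m ∷ [])
                (≡.trans (inv-++-high r₀ m (suc m) r₀<m ℕ.≤-refl (ℕ.n≤1+n m))
                         (≡.trans (≡.cong (inv r₀ ℕ.+_) inv-m-1+m) (ℕ.+-identityʳ _)))
                (≡.trans (pk-++-high r₁ r₂ r m (suc m) r₀<m ℕ.≤-refl)
                         (≡.trans (≡.cong (λ b → pk r₀ ℕ.+ b2n b) (<ᵇ-false (ℕ.n≤1+n m))) (ℕ.+-identityʳ _)))
                (≡.trans (val-++-high r₁ r₂ r m (suc m) r₀<m ℕ.≤-refl) (ℕ.+-comm (val r₀) _)) ⟩
      pow R (- 1#) (inv r₀) * (pow R p (pk r₀) * pow R q (b2n (endsInDescent r₀) ℕ.+ val r₀))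
        ≈⟨ *-congˡ (*-congˡ (pow-b2n q (endsInDescent r₀) (val r₀))) ⟩
      pow R (- 1#) (inv r₀) * (pow R p (pk r₀) * (descentFactor r₀ * pow R q (val r₀)))
        ≈⟨ regroup _ _ _ _ ⟩
      descentFactor r₀ * wt r₀ ∎
      where
      r₀ = r₁ ∷ r₂ ∷ r
      regroup : ∀ s P c Q → s * (P * (c * Q)) ≈ c * (s * (P * Q))
      regroup = solve 4 (λ s P c Q → s :* (P :* (c :* Q)) := c :* (s :* (P :* Q))) refl

    wt-++-top′ : ∀ r₁ r₂ r → All (_< m) (r₁ ∷ r₂ ∷ r) →
                 wt ((r₁ ∷ r₂ ∷ r) ++ suc m ∷ m ∷ []) ≈ - (p * (descentFactor (r₁ ∷ r₂ ∷ r) * wt (r₁ ∷ r₂ ∷ r)))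
    wt-++-top′ r₁ r₂ r r₀<m = begin
      wt (r₀ ++ suc m ∷ m ∷ [])
        ≡⟨ wt-≡ (r₀ ++ suc m ∷ m ∷ [])
                (≡.trans (inv-++-high r₀ (suc m) m r₀<m (ℕ.n≤1+n m) ℕ.≤-refl)
                         (≡.trans (≡.cong (inv r₀ ℕ.+_) inv-1+m-m) (ℕ.+-comm _ 1)))
                (≡.trans (pk-++-high r₁ r₂ r (suc m) m r₀<m (ℕ.n≤1+n m))
                         (≡.trans (≡.cong (λ b → pk r₀ ℕ.+ b2n b) (<ᵇ-true m<1+m)) (ℕ.+-comm _ 1)))
                (≡.trans (val-++-high r₁ r₂ r (suc m) m r₀<m (ℕ.n≤1+n m)) (ℕ.+-comm (val r₀) _)) ⟩
      (- 1# * pow R (- 1#) (inv r₀)) * ((p * pow R p (pk r₀)) * pow R q (b2n (endsInDescent r₀) ℕ.+ val r₀))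
        ≈⟨ *-congˡ (*-congˡ (pow-b2n q (endsInDescent r₀) (val r₀))) ⟩
      (- 1# * pow R (- 1#) (inv r₀)) * ((p * pow R p (pk r₀)) * (descentFactor r₀ * pow R q (val r₀)))
        ≈⟨ regroup _ _ _ _ ⟩
      - (p * (descentFactor r₀ * wt r₀)) ∎
      where
      r₀ = r₁ ∷ r₂ ∷ r
      regroup : ∀ s P c Q → (- 1# * s) * ((p * P) * (c * Q)) ≈ - (p * (c * (s * (P * Q))))
      regroup = solve 5 (λ p s P c Q → ((:- 1̂) :* s) :* ((p :* P) :* (c :* Q)) := :- (p :* (c :* (s :* (P :* Q))))) refl p

    paired : (AD → AD → Carrier) → List ℕ → Carrier
    paired φ w = term φ w + term φ (map swap w)

    paired-repeated : ∀ φ w → distinct w ≡ false → paired φ w ≈ 0#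
    paired-repeated φ w dist =
      trans (reflexive (≡.cong₂ _+_ (term-repeated φ w dist) (term-repeated φ (map swap w) (≡.trans (distinct-swap w) dist))))
            (+-identityˡ 0#)

    paired-top-∷ : ∀ φ r₁ r₂ r → All (_< m) (r₁ ∷ r₂ ∷ r) → distinct (r₁ ∷ r₂ ∷ r) ≡ true →
                   paired φ (m ∷ suc m ∷ r₁ ∷ r₂ ∷ r)
                     ≈ (frontFactor (firstPair (r₁ ∷ r₂ ∷ r)) * (p * φ a (lastPair (r₁ ∷ r₂ ∷ r)) - φ d (lastPair (r₁ ∷ r₂ ∷ r))))
                       * wt (r₁ ∷ r₂ ∷ r)
    paired-top-∷ φ r₁ r₂ r r₀<m dist = begin
      term φ (m ∷ suc m ∷ r₀) + term φ (map swap (m ∷ suc m ∷ r₀))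
        ≡⟨ ≡.cong₂ _+_ (term-distinct φ (m ∷ suc m ∷ r₀) dist₁)
                       (≡.trans (≡.cong (term φ) swapped) (term-distinct φ (suc m ∷ m ∷ r₀) dist₂)) ⟩
      φ (firstPair (m ∷ suc m ∷ r₀)) l * wt (m ∷ suc m ∷ r₀)
        + φ (firstPair (suc m ∷ m ∷ r₀)) l * wt (suc m ∷ m ∷ r₀)
        ≡⟨ ≡.cong₂ (λ u v → φ u l * wt (m ∷ suc m ∷ r₀) + φ v l * wt (suc m ∷ m ∷ r₀)) first-a first-d ⟩
      φ a l * wt (m ∷ suc m ∷ r₀) + φ d l * wt (suc m ∷ m ∷ r₀)
        ≈⟨ +-cong (*-congˡ (wt-top-∷ r₁ r₂ r r₀<m)) (*-congˡ (wt-top′-∷ r₁ r₂ r r₀<m)) ⟩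
      φ a l * (p * (ascentFactor r₁ r₂ * wt r₀)) + φ d l * (- (ascentFactor r₁ r₂ * wt r₀))
        ≈⟨ factor _ _ _ _ ⟩
      (ascentFactor r₁ r₂ * (p * φ a l - φ d l)) * wt r₀
        ≡⟨ ≡.cong (λ c → (c * (p * φ a l - φ d l)) * wt r₀) (≡.sym (frontFactor-firstPair r₁ r₂ r)) ⟩
      (frontFactor (firstPair r₀) * (p * φ a l - φ d l)) * wt r₀ ∎
      where
      r₀ = r₁ ∷ r₂ ∷ r
      l = lastPair r₀
      swapped : map swap (m ∷ suc m ∷ r₀) ≡ suc m ∷ m ∷ r₀
      swapped = ≡.cong₂ _∷_ swap-m (≡.cong₂ _∷_ swap-1+m (map-swap-< r₀ r₀<m))
      dist₁ : distinct (m ∷ suc m ∷ r₀) ≡ true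
      dist₁ = ≡.trans (distinct-top-∷ r₀ r₀<m) dist
      dist₂ : distinct (suc m ∷ m ∷ r₀) ≡ true
      dist₂ = ≡.trans (distinct-high-∷ (suc m) m r₀ r₀<m (ℕ.n≤1+n m) ℕ.≤-refl 1+m≢m) dist
      first-a : firstPair (m ∷ suc m ∷ r₀) ≡ a
      first-a rewrite <ᵇ-true m<1+m = ≡.refl
      first-d : firstPair (suc m ∷ m ∷ r₀) ≡ d
      first-d rewrite <ᵇ-false {suc m} {m} (ℕ.n≤1+n m) = ≡.refl
      factor : ∀ A B c w → A * (p * (c * w)) + B * (- (c * w)) ≈ (c * (p * A - B)) * w
      factor = solve 5 (λ p A B c w → A :* (p :* (c :* w)) :+ B :* (:- (c :* w)) := (c :* (p :* A :- B)) :* w) refl p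

    paired-++-top : ∀ φ r₁ r₂ r → All (_< m) (r₁ ∷ r₂ ∷ r) → distinct (r₁ ∷ r₂ ∷ r) ≡ true →
                    paired φ ((r₁ ∷ r₂ ∷ r) ++ m ∷ suc m ∷ [])
                      ≈ (backFactor (lastPair (r₁ ∷ r₂ ∷ r)) * (φ (firstPair (r₁ ∷ r₂ ∷ r)) a - p * φ (firstPair (r₁ ∷ r₂ ∷ r)) d))
                        * wt (r₁ ∷ r₂ ∷ r)
    paired-++-top φ r₁ r₂ r r₀<m dist = begin
      term φ (r₀ ++ m ∷ suc m ∷ []) + term φ (map swap (r₀ ++ m ∷ suc m ∷ []))
        ≡⟨ ≡.cong₂ _+_ (term-distinct φ (r₀ ++ m ∷ suc m ∷ []) dist₁)
                       (≡.trans (≡.cong (term φ) swapped) (term-distinct φ (r₀ ++ suc m ∷ m ∷ []) dist₂)) ⟩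
      φ f (lastPair (r₀ ++ m ∷ suc m ∷ [])) * wt (r₀ ++ m ∷ suc m ∷ [])
        + φ f (lastPair (r₀ ++ suc m ∷ m ∷ [])) * wt (r₀ ++ suc m ∷ m ∷ [])
        ≡⟨ ≡.cong₂ (λ u v → φ f u * wt (r₀ ++ m ∷ suc m ∷ []) + φ f v * wt (r₀ ++ suc m ∷ m ∷ [])) last-a last-d ⟩
      φ f a * wt (r₀ ++ m ∷ suc m ∷ []) + φ f d * wt (r₀ ++ suc m ∷ m ∷ [])
        ≈⟨ +-cong (*-congˡ (wt-++-top r₁ r₂ r r₀<m)) (*-congˡ (wt-++-top′ r₁ r₂ r r₀<m)) ⟩
      φ f a * (descentFactor r₀ * wt r₀) + φ f d * (- (p * (descentFactor r₀ * wt r₀)))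
        ≈⟨ factor _ _ _ _ ⟩
      (descentFactor r₀ * (φ f a - p * φ f d)) * wt r₀
        ≡⟨ ≡.cong (λ c → (c * (φ f a - p * φ f d)) * wt r₀) (≡.sym (backFactor-lastPair r₁ r₂ r dist)) ⟩
      (backFactor (lastPair r₀) * (φ f a - p * φ f d)) * wt r₀ ∎
      where
      r₀ = r₁ ∷ r₂ ∷ r
      f = firstPair r₀
      swapped : map swap (r₀ ++ m ∷ suc m ∷ []) ≡ r₀ ++ suc m ∷ m ∷ []
      swapped = ≡.trans (List.map-++ swap r₀ (m ∷ suc m ∷ []))
                        (≡.cong₂ _++_ (map-swap-< r₀ r₀<m) (≡.cong₂ _∷_ swap-m (≡.cong (_∷ []) swap-1+m)))
      dist₁ : distinct (r₀ ++ m ∷ suc m ∷ []) ≡ true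
      dist₁ = ≡.trans (distinct-++-top r₀ r₀<m) dist
      dist₂ : distinct (r₀ ++ suc m ∷ m ∷ []) ≡ true
      dist₂ = ≡.trans (distinct-++-high r₀ (suc m) m r₀<m (ℕ.n≤1+n m) ℕ.≤-refl 1+m≢m) dist
      last-a : lastPair (r₀ ++ m ∷ suc m ∷ []) ≡ a
      last-a rewrite lastPair-++ r₀ m (suc m) | <ᵇ-true m<1+m = ≡.refl
      last-d : lastPair (r₀ ++ suc m ∷ m ∷ []) ≡ d
      last-d rewrite lastPair-++ r₀ (suc m) m | <ᵇ-false {suc m} {m} (ℕ.n≤1+n m) = ≡.refl
      factor : ∀ A B c w → A * (c * w) + B * (- (p * (c * w))) ≈ (c * (A - p * B)) * w
      factor = solve 5 (λ p A B c w → A :* (c :* w) :+ B :* (:- (p :* (c :* w))) := (c :* (A :- p :* B)) :* w) refl p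

    paired-top-boundaries : ∀ φ r₁ r₂ r → All (_< m) (r₁ ∷ r₂ ∷ r) →
      paired φ (m ∷ suc m ∷ r₁ ∷ r₂ ∷ r) + paired φ ((r₁ ∷ r₂ ∷ r) ++ m ∷ suc m ∷ []) ≈ term (step φ) (r₁ ∷ r₂ ∷ r)
    paired-top-boundaries φ r₁ r₂ r r₀<m = by-distinctness (distinct (r₁ ∷ r₂ ∷ r)) ≡.refl
      where
      r₀ = r₁ ∷ r₂ ∷ r
      by-distinctness : ∀ b → distinct r₀ ≡ b →
        paired φ (m ∷ suc m ∷ r₀) + paired φ (r₀ ++ m ∷ suc m ∷ []) ≈ term (step φ) r₀
      by-distinctness true dist = begin
        paired φ (m ∷ suc m ∷ r₀) + paired φ (r₀ ++ m ∷ suc m ∷ [])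
          ≈⟨ +-cong (paired-top-∷ φ r₁ r₂ r r₀<m dist) (paired-++-top φ r₁ r₂ r r₀<m dist) ⟩
        _ * wt r₀ + _ * wt r₀
          ≈⟨ distribʳ (wt r₀) _ _ ⟨
        step φ (firstPair r₀) (lastPair r₀) * wt r₀
          ≡⟨ term-distinct (step φ) r₀ dist ⟨
        term (step φ) r₀ ∎
      by-distinctness false dist = begin
        paired φ (m ∷ suc m ∷ r₀) + paired φ (r₀ ++ m ∷ suc m ∷ [])
          ≈⟨ +-cong (paired-repeated φ (m ∷ suc m ∷ r₀) (≡.trans (distinct-top-∷ r₀ r₀<m) dist))
                    (paired-repeated φ (r₀ ++ m ∷ suc m ∷ []) (≡.trans (distinct-++-top r₀ r₀<m) dist)) ⟩
        0# + 0#            ≈⟨ +-identityˡ 0# ⟩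
        0#                 ≡⟨ term-repeated (step φ) r₀ dist ⟨
        term (step φ) r₀   ∎

  module Cancellation (φ : AD → AD → Carrier) (k : ℕ) where
    m N : ℕ
    m = suc (suc k)
    N = suc (suc m)
    open TopSwap m
    open Boundary m

    m<N : m < N
    m<N = ℕ.m<n⇒m<1+n ℕ.≤-refl

    1+m<N : suc m < N
    1+m<N = ℕ.≤-refl

    ifTrue ifFalse : Bool → Carrier → Carrier
    ifTrue  b x = if b then x else 0#
    ifFalse b x = if b then 0# else x

    ifTrue-zero : ∀ b {x} → x ≈ 0# → ifTrue b x ≈ 0#
    ifTrue-zero true  x≈0 = x≈0
    ifTrue-zero false x≈0 = refl

    ifFalse-zero : ∀ b {x} → x ≈ 0# → ifFalse b x ≈ 0#
    ifFalse-zero true  x≈0 = refl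
    ifFalse-zero false x≈0 = x≈0

    -- The swap pairs each permutation in which m + 1 precedes m with one in which m comes first.
    total-paired : total φ N ≈ sumWords N N (λ w → ifTrue (mFirst w) (paired φ w))
    total-paired = begin
      sumWords N N (term φ)
        ≈⟨ sumWords-cong′ N N split ⟩
      sumWords N N (λ w → first w + second w)
        ≈⟨ sumWords-+ N N first second ⟩
      sumWords N N first + sumWords N N second
        ≈⟨ +-congˡ (trans (sumWords-swap N m second) (sumWords-cong N N swapped)) ⟩
      sumWords N N first + sumWords N N firstSwapped
        ≈⟨ sumWords-+ N N first firstSwapped ⟨
      sumWords N N (λ w → first w + firstSwapped w)
        ≈⟨ sumWords-cong′ N N merge ⟩
      sumWords N N (λ w → ifTrue (mFirst w) (paired φ w)) ∎
      where
      first second firstSwapped : List ℕ → Carrier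
      first        w = ifTrue  (mFirst w) (term φ w)
      second       w = ifFalse (mFirst w) (term φ w)
      firstSwapped w = ifTrue  (mFirst w) (term φ (map swap w))
      split : ∀ w → term φ w ≈ first w + second w
      split w with mFirst w
      ... | true  = sym (+-identityʳ _)
      ... | false = sym (+-identityˡ _)
      merge : ∀ w → first w + firstSwapped w ≈ ifTrue (mFirst w) (paired φ w)
      merge w with mFirst w
      ... | true  = refl
      ... | false = +-identityˡ 0#
      swapped : ∀ w → length w ≡ N → All (_< N) w → second (map swap w) ≈ firstSwapped w
      swapped w len w<N = by-distinctness (distinct w) ≡.refl
        where
        by-distinctness : ∀ b → distinct w ≡ b → second (map swap w) ≈ firstSwapped w
        by-distinctness false dist =
          trans (ifFalse-zero (mFirst (map swap w)) vanishes) (sym (ifTrue-zero (mFirst w) vanishes))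
          where vanishes = reflexive (term-repeated φ (map swap w) (≡.trans (distinct-swap w) dist))
        by-distinctness true dist rewrite mFirst-swap w (distinct-full-occurs N w m dist w<N len m<N) with mFirst w
        ... | true  = refl
        ... | false = refl

    paired-interior : ∀ w → distinct w ≡ true → All (_< N) w → length w ≡ N →
                      topPairAtStart w ≡ false → topPairAtEnd w ≡ false → paired φ w ≈ 0#
    paired-interior w dist w<N len ns ne = begin
      term φ w + term φ (map swap w)
        ≡⟨ ≡.cong₂ _+_ (term-distinct φ w dist) (term-distinct φ (map swap w) (≡.trans (distinct-swap w) dist)) ⟩
      φ (firstPair w) (lastPair w) * wt w + φ (firstPair (map swap w)) (lastPair (map swap w)) * wt (map swap w)
        ≡⟨ ≡.cong₂ (λ u v → φ (firstPair w) (lastPair w) * wt w + φ u v * wt (map swap w)) first≡ last≡ ⟩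
      φ (firstPair w) (lastPair w) * wt w + φ (firstPair w) (lastPair w) * wt (map swap w)
        ≈⟨ +-congˡ (*-congˡ (wt-opposite (map swap w) w (inv-swap-±1 w dist om o1+m) pk≡ val≡)) ⟩
      φ (firstPair w) (lastPair w) * wt w + φ (firstPair w) (lastPair w) * - wt w
        ≈⟨ cancel _ _ ⟩
      0# ∎
      where
      om   = distinct-full-occurs N w m dist w<N len m<N
      o1+m = distinct-full-occurs N w (suc m) dist w<N len 1+m<N
      statistics = swap-preserves-statistics w dist w<N ns ne
      pk≡ = proj₁ statistics
      val≡ = proj₁ (proj₂ statistics)
      first≡ = proj₁ (proj₂ (proj₂ statistics))
      last≡ = proj₂ (proj₂ (proj₂ statistics))
      cancel : ∀ A x → A * x + A * - x ≈ 0#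
      cancel = solve 2 (λ A x → A :* x :+ A :* (:- x) := 0̂) refl

    at-start at-end : List ℕ → Carrier
    at-start w = ifTrue (startsWithTop w) (paired φ w)
    at-end   w = ifTrue (endsWithTop w) (paired φ w)

    mFirst-paired-split : ∀ w → length w ≡ N → All (_< N) w → ifTrue (mFirst w) (paired φ w) ≈ at-start w + at-end w
    mFirst-paired-split w@(x ∷ y ∷ z ∷ r) len w<N = by-distinctness (distinct w) ≡.refl
      where
      by-distinctness : ∀ b → distinct w ≡ b → ifTrue (mFirst w) (paired φ w) ≈ at-start w + at-end w
      by-distinctness false dist = trans (ifTrue-zero (mFirst w) vanishes)
        (sym (trans (+-cong (ifTrue-zero (startsWithTop w) vanishes) (ifTrue-zero (endsWithTop w) vanishes)) (+-identityˡ 0#)))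
        where vanishes = paired-repeated φ w dist
      by-distinctness true dist with mFirst w in mf | startsWithTop w in s | endsWithTop w in e
      ... | false | false | false = sym (+-identityˡ 0#)
      ... | false | true  | _     with () ← ≡.trans (≡.sym (startsWithTop⇒mFirst w s)) mf
      ... | false | false | true  with () ← ≡.trans (≡.sym (endsWithTop⇒mFirst w dist e)) mf
      ... | true  | true  | true  with () ← ≡.trans (≡.sym (startsWithTop⇒¬endsWithTop x y z r dist s)) e
      ... | true  | true  | false = sym (+-identityʳ _)
      ... | true  | false | true  = sym (+-identityˡ _)
      ... | true  | false | false =
        trans (paired-interior w dist w<N len (not-at-start (topPairAtStart w) ≡.refl) (not-at-end (topPairAtEnd w) ≡.refl))
              (sym (+-identityˡ 0#))
        where
        not-at-start : ∀ b → topPairAtStart w ≡ b → topPairAtStart w ≡ false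
        not-at-start false t = t
        not-at-start true  t with () ← ≡.trans (≡.sym (mFirst-topPairAtStart w mf t)) s
        not-at-end : ∀ b → topPairAtEnd w ≡ b → topPairAtEnd w ≡ false
        not-at-end false t = t
        not-at-end true  t with () ← ≡.trans (≡.sym (mFirst-topPairAtEnd w dist mf t)) e

    sum-at-start : sumWords N N at-start ≈ sumWords m m (λ r → paired φ (m ∷ suc m ∷ r))
    sum-at-start = begin
      sumWords m N (λ r → sumBelow N (λ y → sumBelow N (λ x → at-start (x ∷ y ∷ r))))
        ≈⟨ sumWords-cong′ m N select ⟩
      sumWords m N prepended
        ≈⟨ sumWords-shrink m (suc m) prepended
             (λ r o → paired-repeated φ (m ∷ suc m ∷ r) (distinct-++-shared (suc m) (m ∷ suc m ∷ []) r o1+m o)) ⟩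
      sumWords m (suc m) prepended
        ≈⟨ sumWords-shrink m m prepended
             (λ r o → paired-repeated φ (m ∷ suc m ∷ r) (distinct-++-shared m (m ∷ suc m ∷ []) r om o)) ⟩
      sumWords m m prepended ∎
      where
      prepended : List ℕ → Carrier
      prepended r = paired φ (m ∷ suc m ∷ r)
      om : occurs m (m ∷ suc m ∷ []) ≡ true
      om = occurs-head m (suc m ∷ [])
      o1+m : occurs (suc m) (m ∷ suc m ∷ []) ≡ true
      o1+m = occurs-tail {suc m} m (suc m ∷ []) (occurs-head (suc m) [])
      select : ∀ r → sumBelow N (λ y → sumBelow N (λ x → at-start (x ∷ y ∷ r))) ≈ prepended r
      select r = begin
        sumBelow N (λ y → sumBelow N (λ x → at-start (x ∷ y ∷ r)))
          ≈⟨ sumBelow-cong N (λ y _ → sumBelow-single N m {λ x → at-start (x ∷ y ∷ r)} m<N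
               (λ x _ x≢m → reflexive (≡.cong (λ b → ifTrue b (paired φ (x ∷ y ∷ r))) (isTop-≢ˡ y x≢m)))) ⟩
        sumBelow N (λ y → at-start (m ∷ y ∷ r))
          ≈⟨ sumBelow-single N (suc m) {λ y → at-start (m ∷ y ∷ r)} 1+m<N
               (λ y _ y≢1+m → reflexive (≡.cong (λ b → ifTrue b (paired φ (m ∷ y ∷ r))) (isTop-≢ʳ {m} y≢1+m))) ⟩
        at-start (m ∷ suc m ∷ r)
          ≡⟨ ≡.cong (λ b → ifTrue b (prepended r)) isTop-m ⟩
        prepended r ∎

    sum-at-end : sumWords N N at-end ≈ sumWords m m (λ r → paired φ (r ++ m ∷ suc m ∷ []))
    sum-at-end = begin
      sumWords (suc (suc m)) N at-end
        ≈⟨ sumWords-snoc (suc m) N at-end ⟩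
      sumWords (suc m) N (λ r′ → sumBelow N (λ y → at-end (r′ ++ y ∷ [])))
        ≈⟨ sumWords-snoc m N (λ r′ → sumBelow N (λ y → at-end (r′ ++ y ∷ []))) ⟩
      sumWords m N (λ r → sumBelow N (λ x → sumBelow N (λ y → at-end ((r ++ x ∷ []) ++ y ∷ []))))
        ≈⟨ sumWords-cong′ m N select ⟩
      sumWords m N appended
        ≈⟨ sumWords-shrink m (suc m) appended
             (λ r o → paired-repeated φ (r ++ m ∷ suc m ∷ []) (distinct-++-shared (suc m) r _ o o1+m)) ⟩
      sumWords m (suc m) appended
        ≈⟨ sumWords-shrink m m appended
             (λ r o → paired-repeated φ (r ++ m ∷ suc m ∷ []) (distinct-++-shared m r _ o om)) ⟩
      sumWords m m appended ∎
      where
      appended : List ℕ → Carrier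
      appended r = paired φ (r ++ m ∷ suc m ∷ [])
      om : occurs m (m ∷ suc m ∷ []) ≡ true
      om = occurs-head m (suc m ∷ [])
      o1+m : occurs (suc m) (m ∷ suc m ∷ []) ≡ true
      o1+m = occurs-tail {suc m} m (suc m ∷ []) (occurs-head (suc m) [])
      at-end-pair : ∀ r x y → at-end ((r ++ x ∷ []) ++ y ∷ []) ≡ ifTrue (isTop x y) (paired φ (r ++ x ∷ y ∷ []))
      at-end-pair r x y rewrite List.++-assoc r (x ∷ []) (y ∷ []) | endsWithTop-++ r x y = ≡.refl
      select : ∀ r → sumBelow N (λ x → sumBelow N (λ y → at-end ((r ++ x ∷ []) ++ y ∷ []))) ≈ appended r
      select r = begin
        sumBelow N (λ x → sumBelow N (λ y → at-end ((r ++ x ∷ []) ++ y ∷ [])))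
          ≈⟨ sumBelow-single N m {λ x → sumBelow N (λ y → at-end ((r ++ x ∷ []) ++ y ∷ []))} m<N
               (λ x _ x≢m → sumBelow-zero N (λ y _ →
                 reflexive (≡.trans (at-end-pair r x y)
                                    (≡.cong (λ b → ifTrue b (paired φ (r ++ x ∷ y ∷ []))) (isTop-≢ˡ y x≢m))))) ⟩
        sumBelow N (λ y → at-end ((r ++ m ∷ []) ++ y ∷ []))
          ≈⟨ sumBelow-single N (suc m) {λ y → at-end ((r ++ m ∷ []) ++ y ∷ [])} 1+m<N
               (λ y _ y≢1+m → reflexive (≡.trans (at-end-pair r m y)
                                                  (≡.cong (λ b → ifTrue b (paired φ (r ++ m ∷ y ∷ []))) (isTop-≢ʳ {m} y≢1+m)))) ⟩
        at-end ((r ++ m ∷ []) ++ suc m ∷ [])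
          ≡⟨ ≡.trans (at-end-pair r m (suc m)) (≡.cong (λ b → ifTrue b (appended r)) isTop-m) ⟩
        appended r ∎

    total-step : total φ N ≈ total (step φ) m
    total-step = begin
      total φ N                                                    ≈⟨ total-paired ⟩
      sumWords N N (λ w → ifTrue (mFirst w) (paired φ w))           ≈⟨ sumWords-cong N N mFirst-paired-split ⟩
      sumWords N N (λ w → at-start w + at-end w)                    ≈⟨ sumWords-+ N N at-start at-end ⟩
      sumWords N N at-start + sumWords N N at-end                   ≈⟨ +-cong sum-at-start sum-at-end ⟩
      sumWords m m prepended + sumWords m m appended                ≈⟨ sumWords-+ m m prepended appended ⟨
      sumWords m m (λ r → prepended r + appended r)                 ≈⟨ sumWords-cong m m boundaries ⟩
      total (step φ) m                                              ∎
      where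
      prepended appended : List ℕ → Carrier
      prepended r = paired φ (m ∷ suc m ∷ r)
      appended  r = paired φ (r ++ m ∷ suc m ∷ [])
      boundaries : ∀ r → length r ≡ m → All (_< m) r → prepended r + appended r ≈ term (step φ) r
      boundaries (r₁ ∷ r₂ ∷ r) _ r₀<m = paired-top-boundaries φ r₁ r₂ r r₀<m

  -- Of the four words of length 2 only 01 (of type aa) and 10 (of type dd, with one inversion) are permutations.
  total-2 : ∀ φ → total φ 2 ≈ φ a a - φ d d
  total-2 φ = begin
    total φ 2
      ≡⟨⟩
    (0# + (φ d d * ((- 1# * 1#) * (1# * 1#)) + 0#)) + ((φ a a * (1# * (1# * 1#)) + (0# + 0#)) + 0#)
      ≈⟨ solve 2 (λ A D → (0̂ :+ (D :* ((:- 1̂ :* 1̂) :* (1̂ :* 1̂)) :+ 0̂))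
                          :+ ((A :* (1̂ :* (1̂ :* 1̂)) :+ (0̂ :+ 0̂)) :+ 0̂)
                          := A :- D) refl (φ a a) (φ d d) ⟩
    φ a a - φ d d ∎

  X : Carrier
  X = 1# - p * q

  -- step, transcribed into solver syntax so that iterates of step unfold definitionally into polynomials.
  module _ {n : ℕ} (pᴾ qᴾ : Polynomial n) where
    frontFactorᴾ backFactorᴾ : AD → Polynomial n
    frontFactorᴾ a = qᴾ
    frontFactorᴾ d = 1̂
    backFactorᴾ a = 1̂
    backFactorᴾ d = qᴾ

    stepᴾ : (AD → AD → Polynomial n) → AD → AD → Polynomial n
    stepᴾ ψ x y = frontFactorᴾ x :* (pᴾ :* ψ a y :- ψ d y) :+ backFactorᴾ y :* (ψ x a :- pᴾ :* ψ x d)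

  tableᴾ : ∀ {n} → Polynomial n → Polynomial n → Polynomial n → Polynomial n → AD → AD → Polynomial n
  tableᴾ A B C D a a = A
  tableᴾ A B C D a d = B
  tableᴾ A B C D d a = C
  tableᴾ A B C D d d = D

  step-diagonal : ∀ φ → step φ a a - step φ d d ≈ (1# + p * q) * (φ a a + φ d d) - (1# + 1#) * (p * φ a d + q * φ d a)
  step-diagonal φ = solve 6 (λ pᴾ qᴾ A B C D →
      stepᴾ pᴾ qᴾ (tableᴾ A B C D) a a :- stepᴾ pᴾ qᴾ (tableᴾ A B C D) d d
        := (1̂ :+ pᴾ :* qᴾ) :* (A :+ D) :- (2̂) :* (pᴾ :* B :+ qᴾ :* C))
    refl p q (φ a a) (φ a d) (φ d a) (φ d d)

  step²-diagonal : ∀ φ → step (step φ) a a - step (step φ) d d ≈ X * X * (φ a a - φ d d)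
  step²-diagonal φ = solve 6 (λ pᴾ qᴾ A B C D →
      stepᴾ pᴾ qᴾ (stepᴾ pᴾ qᴾ (tableᴾ A B C D)) a a :- stepᴾ pᴾ qᴾ (stepᴾ pᴾ qᴾ (tableᴾ A B C D)) d d
        := (1̂ :- pᴾ :* qᴾ) :* (1̂ :- pᴾ :* qᴾ) :* (A :- D))
    refl p q (φ a a) (φ a d) (φ d a) (φ d d)

  total-step : ∀ φ k → total φ (4 ℕ.+ k) ≈ total (step φ) (2 ℕ.+ k)
  total-step φ k = Cancellation.total-step φ k

  total-4k+2 : ∀ k φ → total φ (2 ℕ.+ 4 ℕ.* k) ≈ pow R X (2 ℕ.* k) * (φ a a - φ d d)
  total-4k+2 zero    φ = trans (total-2 φ) (sym (*-identityˡ _))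
  total-4k+2 (suc k) φ = begin
    total φ (2 ℕ.+ 4 ℕ.* suc k)                          ≡⟨ ≡.cong (λ n → total φ (2 ℕ.+ n)) (ℕ.*-suc 4 k) ⟩
    total φ (4 ℕ.+ (2 ℕ.+ (4 ℕ.* k)))                    ≈⟨ total-step φ (2 ℕ.+ 4 ℕ.* k) ⟩
    total (step φ) (4 ℕ.+ 4 ℕ.* k)                       ≈⟨ total-step (step φ) (4 ℕ.* k) ⟩
    total (step (step φ)) (2 ℕ.+ 4 ℕ.* k)                ≈⟨ total-4k+2 k (step (step φ)) ⟩
    E * (step (step φ) a a - step (step φ) d d)           ≈⟨ *-congˡ (step²-diagonal φ) ⟩
    E * (X * X * (φ a a - φ d d))                         ≈⟨ regroup E X (φ a a - φ d d) ⟩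
    X * (X * E) * (φ a a - φ d d)                         ≡⟨ ≡.cong (λ n → pow R X n * (φ a a - φ d d)) (ℕ.*-suc 2 k) ⟨
    pow R X (2 ℕ.* suc k) * (φ a a - φ d d)              ∎
    where
    E = pow R X (2 ℕ.* k)
    regroup : ∀ E X Δ → E * (X * X * Δ) ≈ X * (X * E) * Δ
    regroup = solve 3 (λ E X Δ → E :* (X :* X :* Δ) := X :* (X :* E) :* Δ) refl

  total-4k : ∀ k φ → total φ (4 ℕ.* suc k)
                     ≈ pow R X (2 ℕ.* k) * ((1# + p * q) * (φ a a + φ d d) - (1# + 1#) * (p * φ a d + q * φ d a))
  total-4k k φ = begin
    total φ (4 ℕ.* suc k)                                   ≡⟨ ≡.cong (total φ) (ℕ.*-suc 4 k) ⟩
    total φ (4 ℕ.+ 4 ℕ.* k)                                 ≈⟨ total-step φ (4 ℕ.* k) ⟩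
    total (step φ) (2 ℕ.+ 4 ℕ.* k)                          ≈⟨ total-4k+2 k (step φ) ⟩
    pow R X (2 ℕ.* k) * (step φ a a - step φ d d)           ≈⟨ *-congˡ (step-diagonal φ) ⟩
    pow R X (2 ℕ.* k) * ((1# + p * q) * (φ a a + φ d d) - (1# + 1#) * (p * φ a d + q * φ d a)) ∎

  total-4k-with : ∀ k φ {c} → (1# + p * q) * (φ a a + φ d d) - (1# + 1#) * (p * φ a d + q * φ d a) ≈ c →
                  total φ (4 ℕ.* suc k) ≈ c * pow R X (2 ℕ.* k)
  total-4k-with k φ coefficient = trans (total-4k k φ) (trans (*-congˡ coefficient) (*-comm _ _))

  total-4k-aa : ∀ k → total (indicator a a) (4 ℕ.* suc k) ≈ (1# + p * q) * pow R X (2 ℕ.* k)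
  total-4k-aa k = total-4k-with k (indicator a a)
    (solve 2 (λ p q → (1̂ :+ p :* q) :* (1̂ :+ 0̂) :- 2̂ :* (p :* 0̂ :+ q :* 0̂) := 1̂ :+ p :* q) refl p q)

  total-4k-dd : ∀ k → total (indicator d d) (4 ℕ.* suc k) ≈ (1# + p * q) * pow R X (2 ℕ.* k)
  total-4k-dd k = total-4k-with k (indicator d d)
    (solve 2 (λ p q → (1̂ :+ p :* q) :* (0̂ :+ 1̂) :- 2̂ :* (p :* 0̂ :+ q :* 0̂) := 1̂ :+ p :* q) refl p q)

  total-4k-ad : ∀ k → total (indicator a d) (4 ℕ.* suc k) ≈ - ((1# + 1#) * p) * pow R X (2 ℕ.* k)
  total-4k-ad k = total-4k-with k (indicator a d)
    (solve 2 (λ p q → (1̂ :+ p :* q) :* (0̂ :+ 0̂) :- 2̂ :* (p :* 1̂ :+ q :* 0̂) := :- (2̂ :* p)) refl p q)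

  total-4k-da : ∀ k → total (indicator d a) (4 ℕ.* suc k) ≈ - ((1# + 1#) * q) * pow R X (2 ℕ.* k)
  total-4k-da k = total-4k-with k (indicator d a)
    (solve 2 (λ p q → (1̂ :+ p :* q) :* (0̂ :+ 0̂) :- 2̂ :* (p :* 0̂ :+ q :* 1̂) := :- (2̂ :* q)) refl p q)

  total-4k-all : ∀ k → total (λ _ _ → 1#) (4 ℕ.* suc k) ≈ (1# + 1#) * (1# - p) * (1# - q) * pow R X (2 ℕ.* k)
  total-4k-all k = total-4k-with k (λ _ _ → 1#)
    (solve 2 (λ p q → (1̂ :+ p :* q) :* (1̂ :+ 1̂) :- 2̂ :* (p :* 1̂ :+ q :* 1̂) := 2̂ :* (1̂ :- p) :* (1̂ :- q)) refl p q)

theorem19 : ∀ {c ℓ} (R : CommutativeRing c ℓ) (k : ℕ) (p q : CommutativeRing.Carrier R) →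
    let open CommutativeRing R
        n = 4 ℕ.* suc k
        E = pow R (1# - p * q) (2 ℕ.* k)
    in (SgnAltrunXY R n a a p q ≈ (1# + p * q) * E)
     × (SgnAltrunXY R n d d p q ≈ (1# + p * q) * E)
     × (SgnAltrunXY R n a d p q ≈ - ((1# + 1#) * p) * E)
     × (SgnAltrunXY R n d a p q ≈ - ((1# + 1#) * q) * E)
     × (SgnAltrun R n p q ≈ (1# + 1#) * (1# - p) * (1# - q) * E)
theorem19 R k p q =
    trans (SgnAltrunXY≈total n a a) (total-4k-aa k)
  , trans (SgnAltrunXY≈total n d d) (total-4k-dd k)
  , trans (SgnAltrunXY≈total n a d) (total-4k-ad k)
  , trans (SgnAltrunXY≈total n d a) (total-4k-da k)
  , trans (SgnAltrun≈total n) (total-4k-all k)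
  where
  open CommutativeRing R using (trans)
  open Recurrence R p q
  n = 4 ℕ.* suc k
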